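{- For every partition $\lambda$ and $n\in N(\lambda)$, the formal power series $\mathrm{ss}_{\lambda,n}(x)$ in infinitely many variables is $F$-positive, i.e. it is a finite linear combination with nonnegative integer coefficients of fundamental quasi-symmetric functions $F_a(x)$.
   Context: Partitions are Young diagrams; a skew shape is a horizontal strip if it has at most one box in each column. $N(\lambda)=\{n\ge|\lambda|: n\equiv|\lambda|\pmod 2\}$. For a strong composition $b=(b_1,\dots,b_l)$, $M_b(x)=\sum_{i_1<\dots<i_l}x_{i_1}^{b_1}\cdots x_{i_l}^{b_l}$; for a strong composition $a$, $F_a(x)=\sum_b M_b(x)$ over all strong compositions $b$ obtained from $a$ by splitting each part, in order, into positive parts with the same sum (including $b=a$). An SSOT of shape $\lambda$ is a sequence of partitions $S=(S^1,S'^2,S^2,S'^3,\dots)$ such that, with $S^0=S'^1=\emptyset$: for all $i\ge1$, $S'^i\subseteq S^{i-1}$, $S'^i\subseteq S^i$, and $S^{i-1}/S'^i$, $S^i/S'^i$ are horizontal strips (possibly empty); and $S^i=S'^{i+1}=\lambda$ for all large $i$. Put $m_i(S)=|S^{i-1}/S'^i|+|S^i/S'^i|$, length $n=\sum_im_i(S)$, $x^S=\prod_ix_i^{m_i(S)}$. $\mathrm{ss}_{\lambda,n}(x)=\sum x^S$ over SSOTs of shape $\lambda$ and length $n$. -}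

module Defs where

open import Data.Nat using (ℕ; zero; suc; _+_; _∸_; _≤ᵇ_; _≡ᵇ_; _<_)
open import Data.Bool using (Bool; true; false; _∧_; T)
open import Data.List using (List; []; _∷_; _++_; length; map; concatMap; upTo)
open import Data.Nat.ListAction using (sum)
open import Data.Bool.ListAction using (all)
open import Data.List.Relation.Unary.All using (All)
open import Data.Product using (Σ; _×_; _,_)

isPartition : List ℕ → Bool
isPartition []           = true
isPartition (x ∷ [])     = 1 ≤ᵇ x
isPartition (x ∷ y ∷ xs) = (y ≤ᵇ x) ∧ isPartition (y ∷ xs)

-- j-th part (0-indexed), 0 beyond the length
part : List ℕ → ℕ → ℕ
part []       _       = 0
part (x ∷ xs) zero    = x
part (x ∷ xs) (suc j) = part xs j

size : List ℕ → ℕ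
size = sum

eqList : List ℕ → List ℕ → Bool
eqList []       []       = true
eqList (x ∷ xs) (y ∷ ys) = (x ≡ᵇ y) ∧ eqList xs ys
eqList _        _        = false

-- hstrip outer inner = true iff inner ⊆ outer and outer/inner is a horizontal
-- strip (at most one box per column), i.e. the interlacing
--   outer₁ ≥ inner₁ ≥ outer₂ ≥ inner₂ ≥ …   (parts indexed from 0 below)
hstrip : List ℕ → List ℕ → Bool
hstrip outer inner =
  all (λ j → (part inner j ≤ᵇ part outer j) ∧ (part outer (suc j) ≤ᵇ part inner j))
      (upTo (length outer + length inner))

-- Monomials in x₁, x₂, … : a finite list e = (e₁,…,e_k) denotes
-- x₁^e₁ ⋯ x_k^e_k (all later exponents 0; trailing zeros allowed).

flatten : List ℕ → List ℕ
flatten []            = []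
flatten (zero  ∷ es)  = flatten es
flatten (suc e ∷ es)  = suc e ∷ flatten es

Strong : List ℕ → Set
Strong a = All (λ p → 0 < p) a

-- coefficient of x^e in the monomial quasi-symmetric function M_b
-- (b a strong composition): 1 iff x^e = x_{i₁}^{b₁}⋯x_{i_l}^{b_l}, i₁<…<i_l
Mcoeff : List ℕ → List ℕ → ℕ
Mcoeff b e with eqList (flatten e) b
... | true  = 1
... | false = 0

compositions : ℕ → List (List ℕ)
compositions zero    = [] ∷ []
compositions (suc n) = concatMap step (compositions n)
  where
  step : List ℕ → List (List ℕ)
  step []       = (1 ∷ []) ∷ []
  step (x ∷ xs) = (1 ∷ x ∷ xs) ∷ (suc x ∷ xs) ∷ []

refinements : List ℕ → List (List ℕ)
refinements []      = [] ∷ []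
refinements (p ∷ a) =
  concatMap (λ c → map (λ r → c ++ r) (refinements a)) (compositions p)

-- coefficient of x^e in F_a = Σ_{b ∈ refinements a} M_b
Fcoeff : List ℕ → List ℕ → ℕ
Fcoeff a e = sum (map (λ b → Mcoeff b e) (refinements a))

-- For a monomial e = (e₁,…,e_k), an SSOT S of shape λ with x^S = x^e
-- has m_i(S) = 0 for i > k, which forces S^{i-1} = S'^i = S^i for i > k,
-- hence S^k = λ; so such S is determined by (and equivalent to) the finite
-- data  ((S'^1,S^1), …, (S'^k,S^k))  checked below (with S^0 = ∅).

-- validSSOT prev data e la : prev is S^{i-1}; data lists (S'^j,S^j) for j ≥ i;
-- e lists the required exponents m_j(S) for j ≥ i.
validSSOT : List ℕ → List (List ℕ × List ℕ) → List ℕ → List ℕ → Bool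
validSSOT prev []               []       la = eqList prev la
validSSOT prev ((S' , S) ∷ ds)  (m ∷ es) la =
  isPartition S' ∧ isPartition S ∧ hstrip prev S' ∧ hstrip S S'
  ∧ (((size prev ∸ size S') + (size S ∸ size S')) ≡ᵇ m)
  ∧ validSSOT S ds es la
validSSOT _    _                _        _  = false

-- The type of SSOTs of shape la and length n with x^S = x^e.
-- Its cardinality is the coefficient of x^e in ss_{la,n}(x).
SSOTwt : List ℕ → ℕ → List ℕ → Set
SSOTwt la n e =
  Σ (List (List ℕ × List ℕ)) λ d → T (validSSOT [] d e la ∧ (sum e ≡ᵇ n))

-- Cut every step S^{i-1} ⊇ S'^i ⊆ S^i of an SSOT into single-box moves: remove the boxes of
-- S^{i-1}/S'^i from right to left, then add those of S^i/S'^i from left to right.  An SSOT of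
-- length n with x^S = x^e thus becomes a walk of n box moves from ∅ to λ, divided into
-- consecutive blocks of lengths e₁, e₂, …, each of which is such a monotone run.  Call a move a
-- descent when it cannot continue the run of its predecessor.  A division into blocks is
-- admissible exactly when every descent starts a block, and the number of divisions whose block
-- starts contain a given set is the coefficient of x^e in the fundamental quasisymmetric function
-- of the composition cut out by that set.  Hence ss_{λ,n} = Σ_w F_{des(w)}, summed over the walks
-- w of length n from ∅ to λ.

module Submission where

open import Defs
open import Data.Bool using (Bool; true; false; T; _∧_; _∨_; not; if_then_else_)
open import Data.Bool.Properties using (T-irrelevant; ∧-assoc; ∧-zeroʳ; ∨-zeroʳ; ∨-identityʳ)
open import Data.Empty using (⊥; ⊥-elim)
open import Data.Unit using (tt)
open import Data.Fin using (Fin)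
open import Data.Fin.Properties using (+↔⊎; 0↔⊥; 1↔⊤)
open import Data.List
  using (List; []; _∷_; _++_; length; map; concatMap; filterᵇ; replicate; applyUpTo; upTo; take; drop)
open import Data.List.Properties using (++-assoc; length-++; length-replicate; take++drop≡id)
open import Data.List.Relation.Unary.All using (All; []; _∷_; universal)
open import Data.List.Relation.Unary.All.Properties using (++⁺; map⁺)
open import Data.Maybe using (Maybe; just; nothing)
open import Data.Nat
  using (ℕ; zero; suc; pred; _+_; _*_; _∸_; _≤_; _<_; z≤n; s≤s; _≡ᵇ_; _≤ᵇ_; _<ᵇ_; _≟_; _<?_; _%_)
open import Data.Nat.Properties
open import Data.Nat.ListAction using (sum)
open import Data.Bool.ListAction using (all)
open import Data.Product using (Σ; _×_; _,_; proj₁; proj₂)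
open import Data.Sum using (_⊎_; inj₁; inj₂)
open import Data.Sum.Function.Propositional using (_⊎-cong_)
open import Function.Bundles using (_↔_; mk↔ₛ′; Inverse)
open import Function.Properties.Inverse using (↔-refl; ↔-sym; ↔-trans)
open import Function.Related.Propositional using (module EquationalReasoning)
open import Relation.Nullary using (¬_; yes; no)
open import Relation.Binary.Definitions using (tri<; tri≈; tri>)
open import Relation.Binary.PropositionalEquality

T-∧ˡ : ∀ a {b} → T (a ∧ b) → T a
T-∧ˡ true _ = tt

T-∧ʳ : ∀ a {b} → T (a ∧ b) → T b
T-∧ʳ true t = t

T-∧-intro : ∀ a {b} → T a → T b → T (a ∧ b)
T-∧-intro true _ t = t

T-∧↔× : ∀ a b → T (a ∧ b) ↔ (T a × T b)
T-∧↔× a b = mk↔ₛ′ (λ t → T-∧ˡ a t , T-∧ʳ a t) (λ { (s , t) → T-∧-intro a s t })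
  (λ _ → cong₂ _,_ (T-irrelevant _ _) (T-irrelevant _ _)) (λ _ → T-irrelevant _ _)

T≤ᵇ⇒≤ : ∀ {a b} → T (a ≤ᵇ b) → a ≤ b
T≤ᵇ⇒≤ {a} {b} = ≤ᵇ⇒≤ a b

T<ᵇ⇒< : ∀ {a b} → T (a <ᵇ b) → a < b
T<ᵇ⇒< {a} {b} = <ᵇ⇒< a b

¬T<ᵇ⇒≥ : ∀ {a b} → ¬ T (a <ᵇ b) → b ≤ a
¬T<ᵇ⇒≥ h = ≮⇒≥ (λ p → h (<⇒<ᵇ p))

T≡ᵇ⇒≡ : ∀ {a b} → T (a ≡ᵇ b) → a ≡ b
T≡ᵇ⇒≡ {a} {b} = ≡ᵇ⇒≡ a b

≡⇒T≡ᵇ : ∀ {a b} → a ≡ b → T (a ≡ᵇ b)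
≡⇒T≡ᵇ {a} {b} = ≡⇒≡ᵇ a b

T-implies : ∀ {a b} → T (not a ∨ b) → T a → T b
T-implies {true} {true} _ _ = tt

T-implies-intro : ∀ {a b} → (T a → T b) → T (not a ∨ b)
T-implies-intro {false} h = tt
T-implies-intro {true} h = h tt

T-↔ : ∀ {a b} → (T a → T b) → (T b → T a) → T a ↔ T b
T-↔ f g = mk↔ₛ′ f g (λ _ → T-irrelevant _ _) (λ _ → T-irrelevant _ _)

T-cong : ∀ {a b} → a ≡ b → T a ↔ T b
T-cong refl = ↔-refl

T-true : ∀ {a} → a ≡ true → T a
T-true refl = tt

T-false : ∀ {a} → a ≡ false → ¬ T a
T-false refl ()

T⇒≡true : ∀ {b} → T b → b ≡ true
T⇒≡true {true} _ = refl

iverson : Bool → ℕ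
iverson true  = 1
iverson false = 0

Fin-iverson : ∀ b → Fin (iverson b) ↔ T b
Fin-iverson true  = 1↔⊤
Fin-iverson false = 0↔⊥

Σ-congʳ : ∀ {X : Set} {A B : X → Set} → (∀ x → A x ↔ B x) → Σ X A ↔ Σ X B
Σ-congʳ f = mk↔ₛ′ (λ { (x , a) → x , Inverse.to (f x) a }) (λ { (x , b) → x , Inverse.from (f x) b })
  (λ { (x , b) → cong (x ,_) (Inverse.strictlyInverseˡ (f x) b) })
  (λ { (x , a) → cong (x ,_) (Inverse.strictlyInverseʳ (f x) a) })

×-congʳ : ∀ {A A' X : Set} → A ↔ A' → (A × X) ↔ (A' × X)
×-congʳ f = mk↔ₛ′ (λ { (a , x) → Inverse.to f a , x }) (λ { (a , x) → Inverse.from f a , x })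
  (λ { (a , x) → cong (_, x) (Inverse.strictlyInverseˡ f a) })
  (λ { (a , x) → cong (_, x) (Inverse.strictlyInverseʳ f a) })

⊥-⊎-absorb : ∀ {A Z : Set} → (A → ⊥) → (A ⊎ Z) ↔ Z
⊥-⊎-absorb h = mk↔ₛ′ (λ { (inj₁ a) → ⊥-elim (h a) ; (inj₂ z) → z }) inj₂ (λ _ → refl)
  (λ { (inj₁ a) → ⊥-elim (h a) ; (inj₂ z) → refl })

⊥⊎↔ : ∀ {A : Set} → (⊥ ⊎ A) ↔ A
⊥⊎↔ = ⊥-⊎-absorb (λ ())

⊎-assoc↔ : ∀ {A B C : Set} → ((A ⊎ B) ⊎ C) ↔ (A ⊎ (B ⊎ C))
⊎-assoc↔ = mk↔ₛ′
  (λ { (inj₁ (inj₁ a)) → inj₁ a ; (inj₁ (inj₂ b)) → inj₂ (inj₁ b) ; (inj₂ c) → inj₂ (inj₂ c) })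
  (λ { (inj₁ a) → inj₁ (inj₁ a) ; (inj₂ (inj₁ b)) → inj₁ (inj₂ b) ; (inj₂ (inj₂ c)) → inj₂ c })
  (λ { (inj₁ a) → refl ; (inj₂ (inj₁ b)) → refl ; (inj₂ (inj₂ c)) → refl })
  (λ { (inj₁ (inj₁ a)) → refl ; (inj₁ (inj₂ b)) → refl ; (inj₂ c) → refl })

ΣList : ∀ {A : Set} → List A → (A → Set) → Set
ΣList []       Y = ⊥
ΣList (x ∷ xs) Y = Y x ⊎ ΣList xs Y

ΣList-cong : ∀ {A : Set} (xs : List A) {Y Z : A → Set} → (∀ x → Y x ↔ Z x) → ΣList xs Y ↔ ΣList xs Z
ΣList-cong []       f = ↔-refl
ΣList-cong (x ∷ xs) f = f x ⊎-cong ΣList-cong xs f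

ΣList-++ : ∀ {A : Set} (xs ys : List A) (Y : A → Set) → ΣList (xs ++ ys) Y ↔ (ΣList xs Y ⊎ ΣList ys Y)
ΣList-++ []       ys Y = ↔-sym ⊥⊎↔
ΣList-++ (x ∷ xs) ys Y = ↔-trans (↔-refl ⊎-cong ΣList-++ xs ys Y) (↔-sym ⊎-assoc↔)

ΣList-map : ∀ {A B : Set} (h : A → B) (xs : List A) (Y : B → Set) → ΣList (map h xs) Y ↔ ΣList xs (λ x → Y (h x))
ΣList-map h []       Y = ↔-refl
ΣList-map h (x ∷ xs) Y = ↔-refl ⊎-cong ΣList-map h xs Y

ΣList-concatMap : ∀ {A B : Set} (g : A → List B) (xs : List A) (Y : B → Set) →
                  ΣList (concatMap g xs) Y ↔ ΣList xs (λ x → ΣList (g x) Y)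
ΣList-concatMap g []       Y = ↔-refl
ΣList-concatMap g (x ∷ xs) Y = ↔-trans (ΣList-++ (g x) (concatMap g xs) Y) (↔-refl ⊎-cong ΣList-concatMap g xs Y)

ΣList-filterᵇ : ∀ {A : Set} (p : A → Bool) (xs : List A) (Y : A → Set) →
                ΣList (filterᵇ p xs) Y ↔ ΣList xs (λ x → T (p x) × Y x)
ΣList-filterᵇ p []       Y = ↔-refl
ΣList-filterᵇ p (x ∷ xs) Y with p x
... | true  = mk↔ₛ′ (λ y → tt , y) proj₂ (λ _ → refl) (λ _ → refl) ⊎-cong ΣList-filterᵇ p xs Y
... | false = ↔-trans (ΣList-filterᵇ p xs Y) (↔-sym (⊥-⊎-absorb proj₁))

ΣList-applyUpTo : ∀ (g : ℕ → ℕ) n (W : ℕ → Set) → ΣList (applyUpTo g n) W ↔ Σ ℕ (λ r → T (r <ᵇ n) × W (g r))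
ΣList-applyUpTo g zero    W = mk↔ₛ′ (λ ()) (λ { (r , () , _) }) (λ { (r , () , _) }) (λ ())
ΣList-applyUpTo g (suc n) W = ↔-trans (↔-refl ⊎-cong ΣList-applyUpTo (λ x → g (suc x)) n W) (mk↔ₛ′ f h fh hf)
  where
  f : (W (g 0) ⊎ Σ ℕ (λ r → T (r <ᵇ n) × W (g (suc r)))) → Σ ℕ (λ r → T (r <ᵇ suc n) × W (g r))
  f (inj₁ w)           = 0 , tt , w
  f (inj₂ (r , t , w)) = suc r , t , w
  h : Σ ℕ (λ r → T (r <ᵇ suc n) × W (g r)) → (W (g 0) ⊎ Σ ℕ (λ r → T (r <ᵇ n) × W (g (suc r))))
  h (zero  , t , w) = inj₁ w
  h (suc r , t , w) = inj₂ (r , t , w)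
  fh : ∀ z → f (h z) ≡ z
  fh (zero  , tt , w) = refl
  fh (suc r , t  , w) = refl
  hf : ∀ z → h (f z) ≡ z
  hf (inj₁ w)           = refl
  hf (inj₂ (r , t , w)) = refl

Fin-sum-map : ∀ {A : Set} (f : A → ℕ) (xs : List A) → Fin (sum (map f xs)) ↔ ΣList xs (λ x → Fin (f x))
Fin-sum-map f []       = 0↔⊥
Fin-sum-map f (x ∷ xs) = ↔-trans +↔⊎ (↔-refl ⊎-cong Fin-sum-map f xs)

δ : List ℕ → List ℕ → ℕ
δ x y = iverson (eqList x y)

multiplicity : List ℕ → List (List ℕ) → ℕ
multiplicity x ys = sum (map (δ x) ys)

sum-map-cong : ∀ {A : Set} {f g : A → ℕ} (xs : List A) → (∀ x → f x ≡ g x) → sum (map f xs) ≡ sum (map g xs)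
sum-map-cong []       h = refl
sum-map-cong (x ∷ xs) h = cong₂ _+_ (h x) (sum-map-cong xs h)

sum-map-congᴬ : ∀ {A : Set} {P : A → Set} {f g : A → ℕ} (xs : List A) → All P xs →
                (∀ x → P x → f x ≡ g x) → sum (map f xs) ≡ sum (map g xs)
sum-map-congᴬ []       []       h = refl
sum-map-congᴬ (x ∷ xs) (p ∷ ps) h = cong₂ _+_ (h x p) (sum-map-congᴬ xs ps h)

sum-map-++ : ∀ {A : Set} (f : A → ℕ) (xs ys : List A) → sum (map f (xs ++ ys)) ≡ sum (map f xs) + sum (map f ys)
sum-map-++ f []       ys = refl
sum-map-++ f (x ∷ xs) ys = trans (cong (f x +_) (sum-map-++ f xs ys)) (sym (+-assoc (f x) _ _))

sum-map-concatMap : ∀ {A B : Set} (f : B → ℕ) (g : A → List B) (xs : List A) →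
                    sum (map f (concatMap g xs)) ≡ sum (map (λ x → sum (map f (g x))) xs)
sum-map-concatMap f g []       = refl
sum-map-concatMap f g (x ∷ xs) =
  trans (sum-map-++ f (g x) (concatMap g xs)) (cong (sum (map f (g x)) +_) (sum-map-concatMap f g xs))

sum-map-map : ∀ {A B : Set} (f : B → ℕ) (h : A → B) (xs : List A) → sum (map f (map h xs)) ≡ sum (map (λ x → f (h x)) xs)
sum-map-map f h []       = refl
sum-map-map f h (x ∷ xs) = cong (f (h x) +_) (sum-map-map f h xs)

sum-map-*ʳ : ∀ {A : Set} (g : A → ℕ) (k : ℕ) (xs : List A) → sum (map (λ x → g x * k) xs) ≡ sum (map g xs) * k
sum-map-*ʳ g k []       = refl
sum-map-*ʳ g k (x ∷ xs) = trans (cong (g x * k +_) (sum-map-*ʳ g k xs)) (sym (*-distribʳ-+ k (g x) _))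

sum-map-*ˡ : ∀ {A : Set} (g : A → ℕ) (k : ℕ) (xs : List A) → sum (map (λ x → k * g x) xs) ≡ k * sum (map g xs)
sum-map-*ˡ g k []       = sym (*-zeroʳ k)
sum-map-*ˡ g k (x ∷ xs) = trans (cong (k * g x +_) (sum-map-*ˡ g k xs)) (sym (*-distribˡ-+ k (g x) _))

sum-map-zero : ∀ {A : Set} (xs : List A) → sum (map (λ _ → 0) xs) ≡ 0
sum-map-zero []       = refl
sum-map-zero (x ∷ xs) = sum-map-zero xs

≡ᵇ-refl : ∀ n → (n ≡ᵇ n) ≡ true
≡ᵇ-refl zero    = refl
≡ᵇ-refl (suc n) = ≡ᵇ-refl n

eqList-refl : ∀ x → eqList x x ≡ true
eqList-refl []       = refl
eqList-refl (x ∷ xs) rewrite ≡ᵇ-refl x = eqList-refl xs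

eqList-sound : ∀ x y → T (eqList x y) → x ≡ y
eqList-sound []       []       t = refl
eqList-sound (x ∷ xs) (y ∷ ys) t = cong₂ _∷_ (≡ᵇ⇒≡ x y (T-∧ˡ (x ≡ᵇ y) t)) (eqList-sound xs ys (T-∧ʳ (x ≡ᵇ y) t))

iverson-∧ : ∀ a b → iverson (a ∧ b) ≡ iverson a * iverson b
iverson-∧ true  true  = refl
iverson-∧ true  false = refl
iverson-∧ false b     = refl

Mcoeff≡δ : ∀ b e → Mcoeff b e ≡ δ (flatten e) b
Mcoeff≡δ b e with eqList (flatten e) b
... | true  = refl
... | false = refl

Fcoeff≡multiplicity : ∀ a e → Fcoeff a e ≡ multiplicity (flatten e) (refinements a)
Fcoeff≡multiplicity a e = sum-map-cong (refinements a) (λ b → Mcoeff≡δ b e)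

extendComposition : List ℕ → List (List ℕ)
extendComposition []       = (1 ∷ []) ∷ []
extendComposition (x ∷ xs) = (1 ∷ x ∷ xs) ∷ (suc x ∷ xs) ∷ []

compositions-suc : ∀ n → compositions (suc n) ≡ concatMap extendComposition (compositions n)
compositions-suc n = concatMap-ext _ refl (λ _ _ → refl) (compositions n)
  where
  concatMap-ext : ∀ g → g [] ≡ extendComposition [] → (∀ x xs → g (x ∷ xs) ≡ extendComposition (x ∷ xs)) →
                  ∀ ys → concatMap g ys ≡ concatMap extendComposition ys
  concatMap-ext g h₀ h₁ []              = refl
  concatMap-ext g h₀ h₁ ([] ∷ ys)       = cong₂ _++_ h₀ (concatMap-ext g h₀ h₁ ys)
  concatMap-ext g h₀ h₁ ((x ∷ xs) ∷ ys) = cong₂ _++_ (h₁ x xs) (concatMap-ext g h₀ h₁ ys)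

CompositionOf : ℕ → List ℕ → Set
CompositionOf p c = Strong c × sum c ≡ p

All-concatMap : ∀ {A B : Set} {P : A → Set} {Q : B → Set} (g : A → List B) (xs : List A) →
                (∀ x → P x → All Q (g x)) → All P xs → All Q (concatMap g xs)
All-concatMap g []       h []       = []
All-concatMap g (x ∷ xs) h (p ∷ ps) = ++⁺ (h x p) (All-concatMap g xs h ps)

compositions-sound : ∀ p → All (CompositionOf p) (compositions p)
compositions-sound zero    = ([] , refl) ∷ []
compositions-sound (suc n) rewrite compositions-suc n =
  All-concatMap extendComposition (compositions n) extend-sound (compositions-sound n)
  where
  extend-sound : ∀ x → CompositionOf n x → All (CompositionOf (suc n)) (extendComposition x)
  extend-sound []       (s , refl)        = ((s≤s z≤n ∷ []) , refl) ∷ []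
  extend-sound (x ∷ xs) (px ∷ s , refl) = ((s≤s z≤n ∷ px ∷ s) , refl) ∷ ((s≤s z≤n ∷ s) , refl) ∷ []

-- the unique composition that extendComposition maps onto c
shrinkComposition : List ℕ → List ℕ
shrinkComposition []                  = []
shrinkComposition (zero ∷ cs)         = []
shrinkComposition (suc zero ∷ [])     = []
shrinkComposition (suc zero ∷ y ∷ ys) = y ∷ ys
shrinkComposition (suc (suc y) ∷ ys)  = suc y ∷ ys

shrinkComposition-sound : ∀ c n → Strong c → sum c ≡ suc n → CompositionOf n (shrinkComposition c)
shrinkComposition-sound (suc zero ∷ [])     .0 _       refl = [] , refl
shrinkComposition-sound (suc zero ∷ y ∷ ys) n  (_ ∷ s) refl = s , refl
shrinkComposition-sound (suc (suc y) ∷ ys)  n  (_ ∷ s) refl = (s≤s z≤n ∷ s) , refl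

multiplicity-extendComposition : ∀ c → Strong c → 0 < sum c → ∀ x → Strong x →
                                 multiplicity c (extendComposition x) ≡ δ (shrinkComposition c) x
multiplicity-extendComposition (suc zero ∷ [])     _ _ []           _ = refl
multiplicity-extendComposition (suc zero ∷ y ∷ ys) _ _ []           _ = refl
multiplicity-extendComposition (suc (suc y) ∷ ys)  _ _ []           _ = refl
multiplicity-extendComposition (suc zero ∷ [])     _ _ (suc x ∷ xs) _ = refl
multiplicity-extendComposition (suc zero ∷ y ∷ ys) _ _ (suc x ∷ xs) _ = +-identityʳ _
multiplicity-extendComposition (suc (suc y) ∷ ys)  _ _ (suc x ∷ xs) _ = +-identityʳ _
multiplicity-extendComposition []                  _ () x _
multiplicity-extendComposition (suc _ ∷ _)         _ _ (zero ∷ _) (() ∷ _)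
multiplicity-extendComposition (zero ∷ cs)         (() ∷ _) _ x _

multiplicity-compositions : ∀ n c → CompositionOf n c → multiplicity c (compositions n) ≡ 1
multiplicity-compositions zero    []          _           = refl
multiplicity-compositions zero    (zero ∷ c)  (() ∷ _ , _)
multiplicity-compositions zero    (suc x ∷ c) (_ , ())
multiplicity-compositions (suc n) c (s , eq) rewrite compositions-suc n =
  begin
    multiplicity c (concatMap extendComposition (compositions n))
  ≡⟨ sum-map-concatMap (δ c) extendComposition (compositions n) ⟩
    sum (map (λ x → multiplicity c (extendComposition x)) (compositions n))
  ≡⟨ sum-map-congᴬ (compositions n) (compositions-sound n)
       (λ x px → multiplicity-extendComposition c s (subst (0 <_) (sym eq) (s≤s z≤n)) x (proj₁ px)) ⟩
    multiplicity (shrinkComposition c) (compositions n)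
  ≡⟨ multiplicity-compositions n (shrinkComposition c) (shrinkComposition-sound c n s eq) ⟩
    1
  ∎
  where open ≡-Reasoning

-- a composition of p encoded as p bits, true exactly at the first cell of each part
partStarts : List ℕ → List Bool
partStarts []          = []
partStarts (zero ∷ e)  = partStarts e
partStarts (suc m ∷ e) = true ∷ (replicate m false ++ partStarts e)

-- pointwise implication of bit vectors; false on vectors of different lengths
_⊆ᵇ_ : List Bool → List Bool → Bool
[]       ⊆ᵇ []       = true
(x ∷ xs) ⊆ᵇ (y ∷ ys) = (not x ∨ y) ∧ (xs ⊆ᵇ ys)
[]       ⊆ᵇ (_ ∷ _)  = false
(_ ∷ _)  ⊆ᵇ []       = false

length-partStarts : ∀ c → length (partStarts c) ≡ sum c
length-partStarts []          = refl
length-partStarts (zero ∷ c)  = length-partStarts c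
length-partStarts (suc m ∷ c) =
  cong suc (trans (length-++ (replicate m false)) (cong₂ _+_ (length-replicate m) (length-partStarts c)))

partStarts-++ : ∀ c r → partStarts (c ++ r) ≡ partStarts c ++ partStarts r
partStarts-++ []          r = refl
partStarts-++ (zero ∷ c)  r = partStarts-++ c r
partStarts-++ (suc m ∷ c) r =
  cong (true ∷_) (trans (cong (replicate m false ++_) (partStarts-++ c r)) (sym (++-assoc (replicate m false) (partStarts c) (partStarts r))))

⊆ᵇ-++ : ∀ X X' Y Y' → length X ≡ length X' → ((X ++ Y) ⊆ᵇ (X' ++ Y')) ≡ ((X ⊆ᵇ X') ∧ (Y ⊆ᵇ Y'))
⊆ᵇ-++ []      []        Y Y' _  = refl
⊆ᵇ-++ (x ∷ X) (x' ∷ X') Y Y' eq rewrite ⊆ᵇ-++ X X' Y Y' (cong pred eq) = sym (∧-assoc (not x ∨ x') _ _)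

replicate-false-⊆ᵇ : ∀ q Z → length Z ≡ q → (replicate q false ⊆ᵇ Z) ≡ true
replicate-false-⊆ᵇ zero    []      _  = refl
replicate-false-⊆ᵇ (suc q) (z ∷ Z) eq = replicate-false-⊆ᵇ q Z (cong pred eq)

⊆ᵇ-cancel-replicate : ∀ q A B → ((replicate q false ++ A) ⊆ᵇ (replicate q false ++ B)) ≡ (A ⊆ᵇ B)
⊆ᵇ-cancel-replicate zero    A B = refl
⊆ᵇ-cancel-replicate (suc q) A B = ⊆ᵇ-cancel-replicate q A B

replicate-+ : ∀ {A : Set} x d (a : A) → replicate (x + d) a ≡ replicate x a ++ replicate d a
replicate-+ zero    d a = refl
replicate-+ (suc x) d a = cong (a ∷_) (replicate-+ x d a)

Strong-++⁻ : ∀ c r → Strong (c ++ r) → Strong c × Strong r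
Strong-++⁻ []      r s       = [] , s
Strong-++⁻ (x ∷ c) r (p ∷ s) = let (a , b) = Strong-++⁻ c r s in (p ∷ a) , b

EmptyOrStartsTrue : List Bool → Set
EmptyOrStartsTrue X = (X ≡ []) ⊎ Σ (List Bool) (λ X' → X ≡ true ∷ X')

partStarts-head : ∀ e → EmptyOrStartsTrue (partStarts e)
partStarts-head []          = inj₁ refl
partStarts-head (zero ∷ e)  = partStarts-head e
partStarts-head (suc m ∷ e) = inj₂ (_ , refl)

consPrefix : ℕ → Maybe (List ℕ × List ℕ) → Maybe (List ℕ × List ℕ)
consPrefix x nothing        = nothing
consPrefix x (just (c , r)) = just (x ∷ c , r)

splitPrefix : ℕ → List ℕ → Maybe (List ℕ × List ℕ)
splitPrefix zero    b           = just ([] , b)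
splitPrefix (suc q) []          = nothing
splitPrefix (suc q) (zero ∷ b)  = nothing
splitPrefix (suc q) (suc x ∷ b) = if x ≤ᵇ q then consPrefix (suc x) (splitPrefix (q ∸ x) b) else nothing

splitPrefix-sound : ∀ p b c r → splitPrefix p b ≡ just (c , r) → (b ≡ c ++ r) × (sum c ≡ p)
splitPrefix-sound zero b .[] .b refl = refl , refl
splitPrefix-sound (suc q) (suc x ∷ b) c r eq with x ≤ᵇ q in x≤q | splitPrefix (q ∸ x) b in eq′
splitPrefix-sound (suc q) (suc x ∷ b) .(suc x ∷ c′) r refl | true | just (c′ , .r) =
  let (b≡ , sum≡) = splitPrefix-sound (q ∸ x) b c′ r eq′ in
  cong (suc x ∷_) b≡ , cong suc (trans (cong (x +_) sum≡) (m+[n∸m]≡n (≤ᵇ⇒≤ x q (T-true x≤q))))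

splitPrefix-complete : ∀ c r → Strong c → splitPrefix (sum c) (c ++ r) ≡ just (c , r)
splitPrefix-complete []          r _       = refl
splitPrefix-complete (suc x ∷ c) r (_ ∷ s)
  rewrite T⇒≡true (≤⇒≤ᵇ (m≤m+n x (sum c))) | m+n∸m≡n x (sum c) | splitPrefix-complete c r s = refl

δ-pair : Maybe (List ℕ × List ℕ) → List ℕ → List ℕ → ℕ
δ-pair nothing          _ _ = 0
δ-pair (just (c₀ , r₀)) c r = iverson (eqList c₀ c ∧ eqList r₀ r)

δ-++ : ∀ b c r → Strong c → δ b (c ++ r) ≡ δ-pair (splitPrefix (sum c) b) c r
δ-++ b c r s with eqList b (c ++ r) in b≟cr
... | true rewrite eqList-sound b (c ++ r) (T-true b≟cr) | splitPrefix-complete c r s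
                 | eqList-refl c | eqList-refl r = refl
... | false with splitPrefix (sum c) b in split≡
...   | nothing = refl
...   | just (c₀ , r₀) with eqList c₀ c in c₀≟c | eqList r₀ r in r₀≟r
...     | true  | true  = ⊥-elim (T-false b≟cr (subst (λ z → T (eqList z (c ++ r))) (sym b≡cr) (T-true (eqList-refl (c ++ r)))))
  where
  b≡cr : b ≡ c ++ r
  b≡cr = trans (proj₁ (splitPrefix-sound (sum c) b c₀ r₀ split≡))
               (cong₂ _++_ (eqList-sound c₀ c (T-true c₀≟c)) (eqList-sound r₀ r (T-true r₀≟r)))
...     | true  | false = refl
...     | false | _     = refl

multiplicity-afterSplit : ℕ → Maybe (List ℕ × List ℕ) → List ℕ → ℕ
multiplicity-afterSplit p nothing          a = 0
multiplicity-afterSplit p (just (c₀ , r₀)) a = multiplicity c₀ (compositions p) * multiplicity r₀ (refinements a)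

multiplicity-refinements-∷ : ∀ p a b → multiplicity b (refinements (p ∷ a)) ≡ multiplicity-afterSplit p (splitPrefix p b) a
multiplicity-refinements-∷ p a b =
  begin
    multiplicity b (refinements (p ∷ a))
  ≡⟨ sum-map-concatMap (δ b) (λ c → map (c ++_) (refinements a)) (compositions p) ⟩
    sum (map (λ c → sum (map (δ b) (map (c ++_) (refinements a)))) (compositions p))
  ≡⟨ sum-map-congᴬ (compositions p) (compositions-sound p) split-each ⟩
    sum (map (λ c → sum (map (λ r → δ-pair (splitPrefix p b) c r) (refinements a))) (compositions p))
  ≡⟨ factor (splitPrefix p b) ⟩
    multiplicity-afterSplit p (splitPrefix p b) a
  ∎
  where
  open ≡-Reasoning
  split-each : ∀ c → CompositionOf p c →
               sum (map (δ b) (map (c ++_) (refinements a))) ≡ sum (map (λ r → δ-pair (splitPrefix p b) c r) (refinements a))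
  split-each c (s , refl) = trans (sum-map-map (δ b) (c ++_) (refinements a)) (sum-map-cong (refinements a) (λ r → δ-++ b c r s))
  factor : ∀ m → sum (map (λ c → sum (map (λ r → δ-pair m c r) (refinements a))) (compositions p)) ≡ multiplicity-afterSplit p m a
  factor nothing = trans (sum-map-cong (compositions p) (λ c → sum-map-zero (refinements a))) (sum-map-zero (compositions p))
  factor (just (c₀ , r₀)) =
    trans (sum-map-cong (compositions p) (λ c →
             trans (sum-map-cong (refinements a) (λ r → iverson-∧ (eqList c₀ c) (eqList r₀ r)))
                   (sum-map-*ˡ (δ r₀) (δ c₀ c) (refinements a))))
          (sum-map-*ʳ (δ c₀) (multiplicity r₀ (refinements a)) (compositions p))

consPrefix-nothing : ∀ x m → consPrefix x m ≡ nothing → m ≡ nothing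
consPrefix-nothing x nothing  _ = refl
consPrefix-nothing x (just _) ()

≤ᵇ-false⇒> : ∀ x q → (x ≤ᵇ q) ≡ false → q < x
≤ᵇ-false⇒> x q eq = ≰⇒> (λ x≤q → T-false eq (≤⇒≤ᵇ x≤q))

⊆ᵇ-longer-gap : ∀ q d X (Y : List Bool) → EmptyOrStartsTrue X →
                ((replicate q false ++ X) ⊆ᵇ (replicate (q + suc d) false ++ Y)) ≡ false
⊆ᵇ-longer-gap q d X Y hX
  rewrite replicate-+ q (suc d) false | ++-assoc (replicate q false) (false ∷ replicate d false) Y
        | ⊆ᵇ-cancel-replicate q X (false ∷ (replicate d false ++ Y)) = head-mismatch X hX
  where
  head-mismatch : ∀ X → EmptyOrStartsTrue X → (X ⊆ᵇ (false ∷ (replicate d false ++ Y))) ≡ false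
  head-mismatch .[]           (inj₁ refl)       = refl
  head-mismatch .(true ∷ X′) (inj₂ (X′ , refl)) = refl

⊆ᵇ-splitPrefix-nothing : ∀ b → Strong b → ∀ q X → EmptyOrStartsTrue X → splitPrefix (suc q) b ≡ nothing →
                         ((true ∷ (replicate q false ++ X)) ⊆ᵇ partStarts b) ≡ false
⊆ᵇ-splitPrefix-nothing []          _        q X hX eq = refl
⊆ᵇ-splitPrefix-nothing (suc x ∷ b) (_ ∷ sb) q X hX eq with x ≤ᵇ q in x≤?q
... | false = subst (λ x′ → ((replicate q false ++ X) ⊆ᵇ (replicate x′ false ++ partStarts b)) ≡ false)
                    (trans (+-suc q (x ∸ suc q)) (m+[n∸m]≡n (≤ᵇ-false⇒> x q x≤?q))) (⊆ᵇ-longer-gap q (x ∸ suc q) X (partStarts b) hX)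
... | true  = shorter (q ∸ x) (m+[n∸m]≡n (≤ᵇ⇒≤ x q (T-true x≤?q))) (consPrefix-nothing (suc x) _ eq)
  where
  shorter : ∀ d → x + d ≡ q → splitPrefix d b ≡ nothing →
            ((replicate q false ++ X) ⊆ᵇ (replicate x false ++ partStarts b)) ≡ false
  shorter zero     _    ()
  shorter (suc d′) refl fails
    rewrite replicate-+ x (suc d′) false | ++-assoc (replicate x false) (replicate (suc d′) false) X
          | ⊆ᵇ-cancel-replicate x (replicate (suc d′) false ++ X) (partStarts b) = after-gap b sb fails
    where
    after-gap : ∀ b → Strong b → splitPrefix (suc d′) b ≡ nothing → ((false ∷ (replicate d′ false ++ X)) ⊆ᵇ partStarts b) ≡ false
    after-gap []           _        _     = refl
    after-gap (suc y ∷ b′) sb       fails = ⊆ᵇ-splitPrefix-nothing (suc y ∷ b′) sb d′ X hX fails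
    after-gap (zero ∷ b′)  (() ∷ _) _

multiplicity-refinements : ∀ a → Strong a → ∀ b → Strong b → multiplicity b (refinements a) ≡ iverson (partStarts a ⊆ᵇ partStarts b)
multiplicity-refinements []          _        []          _        = refl
multiplicity-refinements []          _        (suc x ∷ b) _        = refl
multiplicity-refinements []          _        (zero ∷ b)  (() ∷ _)
multiplicity-refinements (suc q ∷ a) (_ ∷ sa) b           sb
  rewrite multiplicity-refinements-∷ (suc q) a b with splitPrefix (suc q) b in split≡
... | nothing = cong iverson (sym (⊆ᵇ-splitPrefix-nothing b sb q (partStarts a) (partStarts-head a) split≡))
... | just (c₀ , r₀) with splitPrefix-sound (suc q) b c₀ r₀ split≡
...   | refl , sum≡ with Strong-++⁻ c₀ r₀ sb
...     | s₀ , sr =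
  begin
    multiplicity c₀ (compositions (suc q)) * multiplicity r₀ (refinements a)
  ≡⟨ cong (_* multiplicity r₀ (refinements a)) (multiplicity-compositions (suc q) c₀ (s₀ , sum≡)) ⟩
    multiplicity r₀ (refinements a) + 0
  ≡⟨ +-identityʳ _ ⟩
    multiplicity r₀ (refinements a)
  ≡⟨ multiplicity-refinements a sa r₀ sr ⟩
    iverson (partStarts a ⊆ᵇ partStarts r₀)
  ≡⟨ cong iverson (sym (first-part c₀ s₀ sum≡)) ⟩
    iverson ((true ∷ (replicate q false ++ partStarts a)) ⊆ᵇ partStarts (c₀ ++ r₀))
  ∎
  where
  open ≡-Reasoning
  first-part : ∀ c → Strong c → sum c ≡ suc q →
               ((true ∷ (replicate q false ++ partStarts a)) ⊆ᵇ partStarts (c ++ r₀)) ≡ (partStarts a ⊆ᵇ partStarts r₀)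
  first-part (zero ∷ c)  (() ∷ _) _
  first-part (suc x ∷ c) _        sum≡′
    rewrite partStarts-++ c r₀ | sym (++-assoc (replicate x false) (partStarts c) (partStarts r₀)) =
    after-first-cell x c (length-tail x c sum≡′)
    where
    length-tail : ∀ x c → suc (x + sum c) ≡ suc q → length (replicate x false ++ partStarts c) ≡ q
    length-tail x c eq =
      trans (length-++ (replicate x false)) (trans (cong₂ _+_ (length-replicate x) (length-partStarts c)) (cong pred eq))
    after-first-cell : ∀ x c → length (replicate x false ++ partStarts c) ≡ q →
      ((replicate q false ++ partStarts a) ⊆ᵇ ((replicate x false ++ partStarts c) ++ partStarts r₀))
        ≡ (partStarts a ⊆ᵇ partStarts r₀)
    after-first-cell x c len≡
      rewrite ⊆ᵇ-++ (replicate q false) (replicate x false ++ partStarts c) (partStarts a) (partStarts r₀)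
                    (trans (length-replicate q) (sym len≡))
            | replicate-false-⊆ᵇ q (replicate x false ++ partStarts c) len≡ = refl

data Mode : Set where
  start inner : Mode

-- fits m bs e: the letters of bs, read against the blocks of x^e, carry a descent bit only at the
-- first letter of a block (in mode inner we are already inside a block)
fits : Mode → List Bool → List ℕ → Bool
fits m     []       []          = true
fits m     (_ ∷ _)  []          = false
fits m     bs       (zero ∷ e)  = fits start bs e
fits m     []       (suc k ∷ e) = false
fits start (b ∷ bs) (suc k ∷ e) = fits inner bs (k ∷ e)
fits inner (b ∷ bs) (suc k ∷ e) = not b ∧ fits inner bs (k ∷ e)

-- the composition whose parts are the runs of bs between descents (the first bit is ignored)
runsFrom : ℕ → List Bool → List ℕ
runsFrom k []           = suc k ∷ []
runsFrom k (true ∷ bs)  = suc k ∷ runsFrom 0 bs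
runsFrom k (false ∷ bs) = runsFrom (suc k) bs

descentComposition : List Bool → List ℕ
descentComposition []       = []
descentComposition (b ∷ bs) = runsFrom 0 bs

Strong-runsFrom : ∀ k bs → Strong (runsFrom k bs)
Strong-runsFrom k []           = s≤s z≤n ∷ []
Strong-runsFrom k (true ∷ bs)  = s≤s z≤n ∷ Strong-runsFrom 0 bs
Strong-runsFrom k (false ∷ bs) = Strong-runsFrom (suc k) bs

Strong-descentComposition : ∀ bs → Strong (descentComposition bs)
Strong-descentComposition []       = []
Strong-descentComposition (b ∷ bs) = Strong-runsFrom 0 bs

replicate-false-∷ʳ : ∀ k (bs : List Bool) → replicate k false ++ (false ∷ bs) ≡ false ∷ (replicate k false ++ bs)
replicate-false-∷ʳ zero    bs = refl
replicate-false-∷ʳ (suc k) bs = cong (false ∷_) (replicate-false-∷ʳ k bs)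

partStarts-runsFrom : ∀ k bs → partStarts (runsFrom k bs) ≡ true ∷ (replicate k false ++ bs)
partStarts-runsFrom k []           = refl
partStarts-runsFrom k (true ∷ bs)  = cong (λ z → true ∷ (replicate k false ++ z)) (partStarts-runsFrom 0 bs)
partStarts-runsFrom k (false ∷ bs) = trans (partStarts-runsFrom (suc k) bs) (cong (true ∷_) (sym (replicate-false-∷ʳ k bs)))

mutual
  fits-start : ∀ bs e → fits start bs e ≡ (bs ⊆ᵇ partStarts e)
  fits-start []       []          = refl
  fits-start (_ ∷ _)  []          = refl
  fits-start []       (zero ∷ e)  = fits-start [] e
  fits-start (b ∷ bs) (zero ∷ e)  = fits-start (b ∷ bs) e
  fits-start []       (suc k ∷ e) = refl
  fits-start (b ∷ bs) (suc k ∷ e) rewrite ∨-zeroʳ (not b) = fits-inner bs k e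

  fits-inner : ∀ bs k e → fits inner bs (k ∷ e) ≡ (bs ⊆ᵇ (replicate k false ++ partStarts e))
  fits-inner []       zero    e = fits-start [] e
  fits-inner (b ∷ bs) zero    e = fits-start (b ∷ bs) e
  fits-inner []       (suc k) e = refl
  fits-inner (b ∷ bs) (suc k) e rewrite ∨-identityʳ (not b) = cong (not b ∧_) (fits-inner bs k e)

partStarts-descentComposition-⊆ᵇ : ∀ bs e → (partStarts (descentComposition bs) ⊆ᵇ partStarts e) ≡ (bs ⊆ᵇ partStarts e)
partStarts-descentComposition-⊆ᵇ []       e = refl
partStarts-descentComposition-⊆ᵇ (b ∷ bs) e rewrite partStarts-runsFrom 0 bs with partStarts-head e
... | inj₁ eq rewrite eq = refl
... | inj₂ (_ , eq) rewrite eq | ∨-zeroʳ (not b) = refl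

partStarts-flatten : ∀ e → partStarts (flatten e) ≡ partStarts e
partStarts-flatten []          = refl
partStarts-flatten (zero ∷ e)  = partStarts-flatten e
partStarts-flatten (suc k ∷ e) = cong (λ z → true ∷ (replicate k false ++ z)) (partStarts-flatten e)

Strong-flatten : ∀ e → Strong (flatten e)
Strong-flatten []          = []
Strong-flatten (zero ∷ e)  = Strong-flatten e
Strong-flatten (suc k ∷ e) = s≤s z≤n ∷ Strong-flatten e

Fcoeff-descentComposition : ∀ bs e → Fcoeff (descentComposition bs) e ≡ iverson (fits start bs e)
Fcoeff-descentComposition bs e =
  begin
    Fcoeff (descentComposition bs) e
  ≡⟨ Fcoeff≡multiplicity (descentComposition bs) e ⟩
    multiplicity (flatten e) (refinements (descentComposition bs))
  ≡⟨ multiplicity-refinements (descentComposition bs) (Strong-descentComposition bs) (flatten e) (Strong-flatten e) ⟩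
    iverson (partStarts (descentComposition bs) ⊆ᵇ partStarts (flatten e))
  ≡⟨ cong (λ z → iverson (partStarts (descentComposition bs) ⊆ᵇ z)) (partStarts-flatten e) ⟩
    iverson (partStarts (descentComposition bs) ⊆ᵇ partStarts e)
  ≡⟨ cong iverson (trans (partStarts-descentComposition-⊆ᵇ bs e) (sym (fits-start bs e))) ⟩
    iverson (fits start bs e)
  ∎
  where open ≡-Reasoning

all-applyUpTo⁻ : ∀ (f : ℕ → Bool) (g : ℕ → ℕ) n → T (all f (applyUpTo g n)) → ∀ j → j < n → T (f (g j))
all-applyUpTo⁻ f g (suc n) t zero _ = T-∧ˡ _ t
all-applyUpTo⁻ f g (suc n) t (suc j) (s≤s j<n) = all-applyUpTo⁻ f (λ x → g (suc x)) n (T-∧ʳ _ t) j j<n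

all-applyUpTo⁺ : ∀ (f : ℕ → Bool) (g : ℕ → ℕ) n → (∀ j → j < n → T (f (g j))) → T (all f (applyUpTo g n))
all-applyUpTo⁺ f g zero h = tt
all-applyUpTo⁺ f g (suc n) h = T-∧-intro _ (h zero (s≤s z≤n)) (all-applyUpTo⁺ f (λ x → g (suc x)) n (λ j j<n → h (suc j) (s≤s j<n)))

behead : List ℕ → List ℕ
behead [] = []
behead (_ ∷ xs) = xs

part-beyond-length : ∀ P j → length P ≤ j → part P j ≡ 0
part-beyond-length [] j _ = refl
part-beyond-length (x ∷ P) (suc j) (s≤s h) = part-beyond-length P j h

part-pos⇒<length : ∀ P j → 1 ≤ part P j → j < length P
part-pos⇒<length P j h with j <? length P
... | yes p = p
... | no np = ⊥-elim (1+n≰n (subst (1 ≤_) (part-beyond-length P j (≮⇒≥ np)) h))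

Positive : List ℕ → Set
Positive = All (1 ≤_)

Decreasing : List ℕ → Set
Decreasing P = ∀ j → part P (suc j) ≤ part P j

isPartition⇒Positive : ∀ P → T (isPartition P) → Positive P
isPartition⇒Positive [] _ = []
isPartition⇒Positive (x ∷ []) t = T≤ᵇ⇒≤ t ∷ []
isPartition⇒Positive (x ∷ y ∷ P) t with isPartition⇒Positive (y ∷ P) (T-∧ʳ _ t)
... | py ∷ ps = ≤-trans py (T≤ᵇ⇒≤ (T-∧ˡ _ t)) ∷ py ∷ ps

isPartition⇒Decreasing : ∀ P → T (isPartition P) → Decreasing P
isPartition⇒Decreasing [] _ j = z≤n
isPartition⇒Decreasing (x ∷ []) _ zero = z≤n
isPartition⇒Decreasing (x ∷ []) _ (suc j) = z≤n
isPartition⇒Decreasing (x ∷ y ∷ P) t zero = T≤ᵇ⇒≤ (T-∧ˡ _ t)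
isPartition⇒Decreasing (x ∷ y ∷ P) t (suc j) = isPartition⇒Decreasing (y ∷ P) (T-∧ʳ _ t) j

Decreasing⇒Positive⇒isPartition : ∀ P → Decreasing P → Positive P → T (isPartition P)
Decreasing⇒Positive⇒isPartition [] d _ = tt
Decreasing⇒Positive⇒isPartition (x ∷ []) d (p ∷ _) = ≤⇒≤ᵇ p
Decreasing⇒Positive⇒isPartition (x ∷ y ∷ P) d (p ∷ ps) = T-∧-intro _ (≤⇒≤ᵇ (d zero)) (Decreasing⇒Positive⇒isPartition (y ∷ P) (λ j → d (suc j)) ps)

part-injective : ∀ P Q → Positive P → Positive Q → (∀ j → part P j ≡ part Q j) → P ≡ Q
part-injective [] [] _ _ h = refl
part-injective [] (y ∷ Q) _ (py ∷ _) h = ⊥-elim (1+n≰n (subst (1 ≤_) (sym (h zero)) py))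
part-injective (x ∷ P) [] (px ∷ _) _ h = ⊥-elim (1+n≰n (subst (1 ≤_) (h zero) px))
part-injective (x ∷ P) (y ∷ Q) (_ ∷ pP) (_ ∷ pQ) h = cong₂ _∷_ (h zero) (part-injective P Q pP pQ (λ j → h (suc j)))

data Move : Set where
  rem add : ℕ → Move

consPart : ℕ → List ℕ → List ℕ
consPart zero [] = []
consPart zero (z ∷ zs) = zero ∷ z ∷ zs
consPart (suc y) xs = suc y ∷ xs

removeBox : ℕ → List ℕ → List ℕ
removeBox r [] = []
removeBox zero (x ∷ xs) = consPart (pred x) xs
removeBox (suc r) (x ∷ xs) = x ∷ removeBox r xs

addBox : ℕ → List ℕ → List ℕ
addBox zero [] = 1 ∷ []
addBox zero (x ∷ xs) = suc x ∷ xs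
addBox (suc r) [] = []
addBox (suc r) (x ∷ xs) = x ∷ addBox r xs

applyMove : Move → List ℕ → List ℕ
applyMove (rem r) P = removeBox r P
applyMove (add r) P = addBox r P

removable : List ℕ → ℕ → Bool
removable P r = part P (suc r) <ᵇ part P r

addable : List ℕ → ℕ → Bool
addable P zero = true
addable P (suc r) = part P (suc r) <ᵇ part P r

validMove : List ℕ → Move → Bool
validMove P (rem r) = removable P r
validMove P (add r) = addable P r

part-consPart : ∀ y xs j → part (consPart y xs) j ≡ part (y ∷ xs) j
part-consPart zero [] zero = refl
part-consPart zero [] (suc j) = refl
part-consPart zero (z ∷ zs) j = refl
part-consPart (suc y) xs j = refl

part-removeBox-same : ∀ r P → part (removeBox r P) r ≡ pred (part P r)
part-removeBox-same r [] = refl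
part-removeBox-same zero (x ∷ xs) = part-consPart (pred x) xs zero
part-removeBox-same (suc r) (x ∷ xs) = part-removeBox-same r xs

part-removeBox-other : ∀ r P j → ¬ (j ≡ r) → part (removeBox r P) j ≡ part P j
part-removeBox-other r [] j h = refl
part-removeBox-other zero (x ∷ xs) zero h = ⊥-elim (h refl)
part-removeBox-other zero (x ∷ xs) (suc j) h = part-consPart (pred x) xs (suc j)
part-removeBox-other (suc r) (x ∷ xs) zero h = refl
part-removeBox-other (suc r) (x ∷ xs) (suc j) h = part-removeBox-other r xs j (λ e → h (cong suc e))

part-addBox-same : ∀ r P → r ≤ length P → part (addBox r P) r ≡ suc (part P r)
part-addBox-same zero [] _ = refl
part-addBox-same zero (x ∷ xs) _ = refl
part-addBox-same (suc r) (x ∷ xs) (s≤s h) = part-addBox-same r xs h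

part-addBox-other : ∀ r P j → ¬ (j ≡ r) → part (addBox r P) j ≡ part P j
part-addBox-other zero [] zero h = ⊥-elim (h refl)
part-addBox-other zero [] (suc j) h = refl
part-addBox-other zero (x ∷ xs) zero h = ⊥-elim (h refl)
part-addBox-other zero (x ∷ xs) (suc j) h = refl
part-addBox-other (suc r) [] j h = refl
part-addBox-other (suc r) (x ∷ xs) zero h = refl
part-addBox-other (suc r) (x ∷ xs) (suc j) h = part-addBox-other r xs j (λ e → h (cong suc e))

addable⇒≤length : ∀ P r → T (addable P r) → r ≤ length P
addable⇒≤length P zero _ = z≤n
addable⇒≤length P (suc r) t = part-pos⇒<length P r (≤-trans (s≤s z≤n) (T<ᵇ⇒< t))

Positive-removeBox : ∀ r P → Positive P → T (removable P r) → Positive (removeBox r P)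
Positive-removeBox r [] _ _ = []
Positive-removeBox zero (suc zero ∷ []) _ _ = []
Positive-removeBox zero (suc zero ∷ y ∷ xs) (_ ∷ py ∷ _) t = ⊥-elim (1+n≰n (≤-trans (≤-trans py (≤-pred (T<ᵇ⇒< {y} {1} t))) z≤n))
Positive-removeBox zero (suc (suc x) ∷ xs) (_ ∷ ps) t = s≤s z≤n ∷ ps
Positive-removeBox zero (zero ∷ xs) (() ∷ _) t
Positive-removeBox (suc r) (x ∷ xs) (p ∷ ps) t = p ∷ Positive-removeBox r xs ps t

Positive-addBox : ∀ r P → Positive P → Positive (addBox r P)
Positive-addBox zero [] _ = s≤s z≤n ∷ []
Positive-addBox zero (x ∷ xs) (_ ∷ ps) = s≤s z≤n ∷ ps
Positive-addBox (suc r) [] _ = []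
Positive-addBox (suc r) (x ∷ xs) (p ∷ ps) = p ∷ Positive-addBox r xs ps

part-removeBox : ∀ r P j → (j ≡ r × part (removeBox r P) j ≡ pred (part P j)) ⊎ (¬ (j ≡ r) × part (removeBox r P) j ≡ part P j)
part-removeBox r P j with j ≟ r
... | yes refl = inj₁ (refl , part-removeBox-same r P)
... | no ne = inj₂ (ne , part-removeBox-other r P j ne)

isPartition-removeBox : ∀ P r → T (isPartition P) → T (removable P r) → T (isPartition (removeBox r P))
isPartition-removeBox P r tP tv = Decreasing⇒Positive⇒isPartition (removeBox r P) d (Positive-removeBox r P (isPartition⇒Positive P tP) tv)
  where
  dP = isPartition⇒Decreasing P tP
  lt : part P (suc r) < part P r
  lt = T<ᵇ⇒< tv
  d : ∀ j → part (removeBox r P) (suc j) ≤ part (removeBox r P) j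
  d j with part-removeBox r P j | part-removeBox r P (suc j)
  ... | inj₁ (refl , e1) | inj₁ (e , _) = ⊥-elim (1+n≰n (≤-reflexive e))
  ... | inj₁ (refl , e1) | inj₂ (_ , e2) rewrite e1 | e2 = <⇒≤pred lt
  ... | inj₂ (_ , e1) | inj₁ (refl , e2) rewrite e1 | e2 = ≤-trans pred[n]≤n (dP j)
  ... | inj₂ (_ , e1) | inj₂ (_ , e2) rewrite e1 | e2 = dP j

part-addBox : ∀ r P j → r ≤ length P → (j ≡ r × part (addBox r P) j ≡ suc (part P j)) ⊎ (¬ (j ≡ r) × part (addBox r P) j ≡ part P j)
part-addBox r P j h with j ≟ r
... | yes refl = inj₁ (refl , part-addBox-same r P h)
... | no ne = inj₂ (ne , part-addBox-other r P j ne)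

isPartition-addBox : ∀ P r → T (isPartition P) → T (addable P r) → T (isPartition (addBox r P))
isPartition-addBox P r tP tv = Decreasing⇒Positive⇒isPartition (addBox r P) d (Positive-addBox r P (isPartition⇒Positive P tP))
  where
  dP = isPartition⇒Decreasing P tP
  rl = addable⇒≤length P r tv
  d : ∀ j → part (addBox r P) (suc j) ≤ part (addBox r P) j
  d j with part-addBox r P j rl | part-addBox r P (suc j) rl
  ... | inj₁ (refl , e1) | inj₁ (e , _) = ⊥-elim (1+n≰n (≤-reflexive e))
  ... | inj₁ (refl , e1) | inj₂ (_ , e2) rewrite e1 | e2 = ≤-trans (dP j) (n≤1+n _)
  ... | inj₂ (_ , e1) | inj₁ (refl , e2) rewrite e1 | e2 = T<ᵇ⇒< tv
  ... | inj₂ (_ , e1) | inj₂ (_ , e2) rewrite e1 | e2 = dP j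

size-consPart : ∀ y xs → size (consPart y xs) ≡ y + size xs
size-consPart zero [] = refl
size-consPart zero (z ∷ zs) = refl
size-consPart (suc y) xs = refl

size-removeBox : ∀ r P → 1 ≤ part P r → suc (size (removeBox r P)) ≡ size P
size-removeBox zero (suc x ∷ xs) _ = cong suc (size-consPart x xs)
size-removeBox (suc r) (x ∷ xs) h = trans (sym (+-suc x _)) (cong (x +_) (size-removeBox r xs h))

size-addBox : ∀ r P → r ≤ length P → size (addBox r P) ≡ suc (size P)
size-addBox zero [] _ = refl
size-addBox zero (x ∷ xs) _ = refl
size-addBox (suc r) (x ∷ xs) (s≤s h) = trans (cong (x +_) (size-addBox r xs h)) (+-suc x _)

size-mono : ∀ S P → (∀ j → part S j ≤ part P j) → size S ≤ size P
size-mono [] P h = z≤n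
size-mono (s ∷ S) [] h = +-mono-≤ (h zero) (size-mono S [] (λ j → h (suc j)))
size-mono (s ∷ S) (p ∷ P) h = +-mono-≤ (h zero) (size-mono S P (λ j → h (suc j)))

size-≡⇒part-≡ : ∀ S P → (∀ j → part S j ≤ part P j) → size S ≡ size P → ∀ j → part S j ≡ part P j
size-≡⇒part-≡ [] [] h e j = refl
size-≡⇒part-≡ [] (p ∷ P) h e j = sym (size0 (p ∷ P) (sym e) j)
  where
  size0 : ∀ P → size P ≡ 0 → ∀ j → part P j ≡ 0
  size0 [] _ j = refl
  size0 (zero ∷ P) e zero = refl
  size0 (zero ∷ P) e (suc j) = size0 P e j
  size0 (suc p ∷ P) () j
size-≡⇒part-≡ (s ∷ S) [] h e j = n≤0⇒n≡0 (h j)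
size-≡⇒part-≡ (s ∷ S) (p ∷ P') h e = aux
  where
  sp : s ≤ p
  sp = h zero
  size-S≤ : size S ≤ size P'
  size-S≤ = size-mono S P' (λ j → h (suc j))
  ep : s ≡ p
  ep = ≤-antisym sp (+-cancelʳ-≤ (size S) p s (≤-trans (+-monoʳ-≤ p size-S≤) (≤-reflexive (sym e))))
  eS : size S ≡ size P'
  eS = +-cancelˡ-≡ s _ _ (trans e (cong (_+ size P') (sym ep)))
  aux : ∀ j → part (s ∷ S) j ≡ part (p ∷ P') j
  aux zero = ep
  aux (suc j) = size-≡⇒part-≡ S P' (λ j → h (suc j)) eS j

Interlaced : List ℕ → List ℕ → ℕ → Set
Interlaced O I j = (part I j ≤ part O j) × (part O (suc j) ≤ part I j)

hstrip⇒Interlaced : ∀ O I → T (hstrip O I) → ∀ j → Interlaced O I j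
hstrip⇒Interlaced O I t j with j <? (length O + length I)
... | yes lt = let u = all-applyUpTo⁻ _ (λ x → x) (length O + length I) t j lt in T≤ᵇ⇒≤ (T-∧ˡ _ u) , T≤ᵇ⇒≤ (T-∧ʳ _ u)
... | no nlt = ≤-reflexive-0 , ≤-reflexive (trans (part-beyond-length O (suc j) O-short) (sym eI))
  where
  eI : part I j ≡ 0
  eI = part-beyond-length I j (≤-trans (m≤n+m (length I) (length O)) (≮⇒≥ nlt))
  ≤-reflexive-0 : part I j ≤ part O j
  ≤-reflexive-0 = subst (_≤ part O j) (sym eI) z≤n
  O-short : length O ≤ suc j
  O-short = ≤-trans (m≤m+n (length O) (length I)) (≤-trans (≮⇒≥ nlt) (n≤1+n j))

Interlaced⇒hstrip : ∀ O I → (∀ j → Interlaced O I j) → T (hstrip O I)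
Interlaced⇒hstrip O I h = all-applyUpTo⁺ _ (λ x → x) (length O + length I) (λ j _ → T-∧-intro _ (≤⇒≤ᵇ (proj₁ (h j))) (≤⇒≤ᵇ (proj₂ (h j))))

Decreasing-+ : ∀ P → Decreasing P → ∀ i k → part P (i + k) ≤ part P i
Decreasing-+ P d i zero = ≤-reflexive (cong (part P) (+-identityʳ i))
Decreasing-+ P d i (suc k) = ≤-trans (subst (λ z → part P z ≤ part P (i + k)) (sym (+-suc i k)) (d (i + k))) (Decreasing-+ P d i k)

Decreasing-mono : ∀ P → Decreasing P → ∀ {i j} → i ≤ j → part P j ≤ part P i
Decreasing-mono P d {i} {j} i≤j = subst (λ z → part P z ≤ part P i) (m+[n∸m]≡n i≤j) (Decreasing-+ P d i (j ∸ i))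

part-suc-behead : ∀ S j → part S (suc j) ≡ part (behead S) j
part-suc-behead [] j = refl
part-suc-behead (x ∷ S) j = refl

firstDeficit : List ℕ → List ℕ → ℕ
firstDeficit [] S = 0
firstDeficit (x ∷ xs) S = if part S 0 <ᵇ x then 0 else suc (firstDeficit xs (behead S))

firstDeficit-spec : ∀ P S → (part S (firstDeficit P S) < part P (firstDeficit P S)) ⊎ (∀ j → part P j ≤ part S j)
firstDeficit-spec [] S = inj₂ (λ j → z≤n)
firstDeficit-spec (x ∷ xs) S with part S 0 <ᵇ x in eq
... | true = inj₁ (T<ᵇ⇒< (T-true eq))
... | false with firstDeficit-spec xs (behead S)
...   | inj₁ lt = inj₁ (subst (_< part xs (firstDeficit xs (behead S))) (sym (part-suc-behead S _)) lt)
...   | inj₂ h = inj₂ g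
  where
  g : ∀ j → part (x ∷ xs) j ≤ part S j
  g zero = ¬T<ᵇ⇒≥ (T-false eq)
  g (suc j) = subst (part xs j ≤_) (sym (part-suc-behead S j)) (h j)

firstDeficit-below : ∀ P S j → j < firstDeficit P S → part P j ≤ part S j
firstDeficit-below (x ∷ xs) S j lt with part S 0 <ᵇ x in eq
firstDeficit-below (x ∷ xs) S zero lt | false = ¬T<ᵇ⇒≥ (T-false eq)
firstDeficit-below (x ∷ xs) S (suc j) (s≤s lt) | false = subst (part xs j ≤_) (sym (part-suc-behead S j)) (firstDeficit-below xs (behead S) j lt)

firstDeficit-unique : ∀ P S r → part S r < part P r → (∀ j → j < r → part P j ≤ part S j) → firstDeficit P S ≡ r
firstDeficit-unique [] S r lt h = ⊥-elim (n≮0 lt)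
firstDeficit-unique (x ∷ xs) S r lt h with part S 0 <ᵇ x in eq
firstDeficit-unique (x ∷ xs) S zero lt h | true = refl
firstDeficit-unique (x ∷ xs) S (suc r) lt h | true = ⊥-elim (<⇒≱ (T<ᵇ⇒< (T-true eq)) (h zero (s≤s z≤n)))
firstDeficit-unique (x ∷ xs) S zero lt h | false = ⊥-elim (T-false eq (<⇒<ᵇ lt))
firstDeficit-unique (x ∷ xs) S (suc r) lt h | false =
  cong suc (firstDeficit-unique xs (behead S) r (subst (_< part xs r) (part-suc-behead S r) lt)
    (λ j j<r → subst (part xs j ≤_) (part-suc-behead S j) (h (suc j) (s≤s j<r))))

lastExcessBelow : List ℕ → List ℕ → ℕ → ℕ
lastExcessBelow Q S zero = 0
lastExcessBelow Q S (suc n) = if part Q n <ᵇ part S n then n else lastExcessBelow Q S n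

LastExcessSpec : List ℕ → List ℕ → ℕ → ℕ → Set
LastExcessSpec Q S n r = (part Q r < part S r) × (∀ j → r < j → j < n → part S j ≤ part Q j)

lastExcessBelow-spec : ∀ Q S n → LastExcessSpec Q S n (lastExcessBelow Q S n) ⊎ (∀ j → j < n → part S j ≤ part Q j)
lastExcessBelow-spec Q S zero = inj₂ (λ j ())
lastExcessBelow-spec Q S (suc n) with part Q n <ᵇ part S n in eq
... | true = inj₁ (T<ᵇ⇒< (T-true eq) , λ j n<j j<sn → ⊥-elim (<⇒≱ n<j (≤-pred j<sn)))
... | false with lastExcessBelow-spec Q S n
...   | inj₁ (lt , h) = inj₁ (lt , g)
  where
  g : ∀ j → lastExcessBelow Q S n < j → j < suc n → part S j ≤ part Q j
  g j p q with j ≟ n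
  ... | yes refl = ¬T<ᵇ⇒≥ (T-false eq)
  ... | no ne = h j p (≤∧≢⇒< (≤-pred q) ne)
...   | inj₂ h = inj₂ g
  where
  g : ∀ j → j < suc n → part S j ≤ part Q j
  g j q with j ≟ n
  ... | yes refl = ¬T<ᵇ⇒≥ (T-false eq)
  ... | no ne = h j (≤∧≢⇒< (≤-pred q) ne)

lastExcess : List ℕ → List ℕ → ℕ
lastExcess Q S = lastExcessBelow Q S (length S)

lastExcess-spec : ∀ Q S → ((part Q (lastExcess Q S) < part S (lastExcess Q S)) × (∀ j → lastExcess Q S < j → part S j ≤ part Q j))
                          ⊎ (∀ j → part S j ≤ part Q j)
lastExcess-spec Q S with lastExcessBelow-spec Q S (length S)
... | inj₁ (lt , h) = inj₁ (lt , g)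
  where
  g : ∀ j → lastExcess Q S < j → part S j ≤ part Q j
  g j p with j <? length S
  ... | yes q = h j p q
  ... | no q = subst (_≤ part Q j) (sym (part-beyond-length S j (≮⇒≥ q))) z≤n
... | inj₂ h = inj₂ g
  where
  g : ∀ j → part S j ≤ part Q j
  g j with j <? length S
  ... | yes q = h j q
  ... | no q = subst (_≤ part Q j) (sym (part-beyond-length S j (≮⇒≥ q))) z≤n

lastExcess-unique : ∀ Q S r → part Q r < part S r → (∀ j → r < j → part S j ≤ part Q j) → lastExcess Q S ≡ r
lastExcess-unique Q S r lt h with lastExcess-spec Q S
... | inj₂ g = ⊥-elim (<⇒≱ lt (g r))
... | inj₁ (lt' , h') with <-cmp (lastExcess Q S) r
...   | tri< a _ _ = ⊥-elim (<⇒≱ lt (h' r a))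
...   | tri≈ _ b _ = b
...   | tri> _ _ c = ⊥-elim (<⇒≱ lt' (h (lastExcess Q S) c))

removalsBefore : List ℕ → List ℕ → ℕ → Bool
removalsBefore P S' c = all (λ j → not (part S' j <ᵇ part P j) ∨ (part P j <ᵇ c)) (upTo (length P))

removalsBefore⇒ : ∀ P S' c → T (removalsBefore P S' c) → ∀ j → part S' j < part P j → part P j < c
removalsBefore⇒ P S' c t j lt with j <? length P
... | yes q = T<ᵇ⇒< (T-implies (all-applyUpTo⁻ _ (λ x → x) (length P) t j q) (<⇒<ᵇ lt))
... | no q = ⊥-elim (n≮0 (subst (part S' j <_) (part-beyond-length P j (≮⇒≥ q)) lt))

removalsBefore⇐ : ∀ P S' c → (∀ j → part S' j < part P j → part P j < c) → T (removalsBefore P S' c)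
removalsBefore⇐ P S' c h = all-applyUpTo⁺ _ (λ x → x) (length P) (λ j _ → T-implies-intro (λ t → <⇒<ᵇ (h j (T<ᵇ⇒< t))))

additionsAfter : List ℕ → List ℕ → ℕ → Bool
additionsAfter Q S c = all (λ j → not (part Q j <ᵇ part S j) ∨ (c ≤ᵇ part Q j)) (upTo (length S))

additionsAfter⇒ : ∀ Q S c → T (additionsAfter Q S c) → ∀ j → part Q j < part S j → c ≤ part Q j
additionsAfter⇒ Q S c t j lt with j <? length S
... | yes q = T≤ᵇ⇒≤ (T-implies (all-applyUpTo⁻ _ (λ x → x) (length S) t j q) (<⇒<ᵇ lt))
... | no q = ⊥-elim (n≮0 (subst (part Q j <_) (part-beyond-length S j (≮⇒≥ q)) lt))

additionsAfter⇐ : ∀ Q S c → (∀ j → part Q j < part S j → c ≤ part Q j) → T (additionsAfter Q S c)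
additionsAfter⇐ Q S c h = all-applyUpTo⁺ _ (λ x → x) (length S) (λ j _ → T-implies-intro (λ t → ≤⇒≤ᵇ (h j (T<ᵇ⇒< t))))

-- Horizontal strips as monotone runs of moves

-- The phase carries the column bound for the next move: removals must go to strictly smaller
-- columns, additions to strictly larger ones, and once a box has been added none is removed.
data Phase : Set where
  free : Phase
  removing adding : ℕ → Phase

allowed : Phase → List ℕ → Move → Bool
allowed free P v = true
allowed (removing c) P (rem r) = part P r <ᵇ c
allowed (removing c) P (add r) = true
allowed (adding c) P (rem r) = false
allowed (adding c) P (add r) = c <ᵇ suc (part P r)

phaseAfter : List ℕ → Move → Phase
phaseAfter P (rem r) = removing (part P r)
phaseAfter P (add r) = adding (suc (part P r))

validRun : Phase → List ℕ → List Move → Bool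
validRun st P [] = true
validRun st P (v ∷ B) = validMove P v ∧ (allowed st P v ∧ validRun (phaseAfter P v) (applyMove v P) B)

applyMoves : List ℕ → List Move → List ℕ
applyMoves P [] = P
applyMoves P (v ∷ B) = applyMoves (applyMove v P) B

Runs : Phase → List ℕ → ℕ → (List ℕ → Set) → Set
Runs st P m Y = Σ (List Move) (λ B → T (validRun st P B ∧ (length B ≡ᵇ m)) × Y (applyMoves P B))

T-∧-regroup : ∀ a1 a2 a3 a4 → T ((a1 ∧ (a2 ∧ a3)) ∧ a4) → T (a1 ∧ a2) × T (a3 ∧ a4)
T-∧-regroup true true a3 a4 t = tt , t
T-∧-regroup true false a3 a4 ()
T-∧-regroup false a2 a3 a4 ()

T-∧-regroup⁻ : ∀ a1 a2 a3 a4 → T (a1 ∧ a2) → T (a3 ∧ a4) → T ((a1 ∧ (a2 ∧ a3)) ∧ a4)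
T-∧-regroup⁻ true true a3 a4 _ t = t

Runs-zero : ∀ st P Y → Runs st P 0 Y ↔ Y P
Runs-zero st P Y = mk↔ₛ′ f (λ y → [] , tt , y) (λ y → refl) g
  where
  f : Runs st P 0 Y → Y P
  f ([] , t , y) = y
  f ((v ∷ B) , t , y) = ⊥-elim (T-∧ʳ (validRun st P (v ∷ B)) t)
  g : ∀ x → ([] , tt , f x) ≡ x
  g ([] , tt , y) = refl
  g ((v ∷ B) , t , y) = ⊥-elim (T-∧ʳ (validRun st P (v ∷ B)) t)

RunsByRemoval : Phase → List ℕ → ℕ → (List ℕ → Set) → Set
RunsByRemoval st P m Y = Σ ℕ (λ r → T (removable P r ∧ allowed st P (rem r)) × Runs (removing (part P r)) (removeBox r P) m Y)
RunsByAddition : Phase → List ℕ → ℕ → (List ℕ → Set) → Set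
RunsByAddition st P m Y = Σ ℕ (λ r → T (addable P r ∧ allowed st P (add r)) × Runs (adding (suc (part P r))) (addBox r P) m Y)

Runs-suc : ∀ st P m Y → Runs st P (suc m) Y ↔ (RunsByRemoval st P m Y ⊎ RunsByAddition st P m Y)
Runs-suc st P m Y = mk↔ₛ′ f g fg gf
  where
  f : Runs st P (suc m) Y → RunsByRemoval st P m Y ⊎ RunsByAddition st P m Y
  f ([] , t , y) = ⊥-elim (T-∧ʳ true t)
  f ((rem r ∷ B) , t , y) =
    let (t₁ , t₂) = T-∧-regroup (removable P r) (allowed st P (rem r)) _ (length B ≡ᵇ m) t in inj₁ (r , t₁ , B , t₂ , y)
  f ((add r ∷ B) , t , y) =
    let (t₁ , t₂) = T-∧-regroup (addable P r) (allowed st P (add r)) _ (length B ≡ᵇ m) t in inj₂ (r , t₁ , B , t₂ , y)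
  g : RunsByRemoval st P m Y ⊎ RunsByAddition st P m Y → Runs st P (suc m) Y
  g (inj₁ (r , t1 , B , t2 , y)) = (rem r ∷ B) , T-∧-regroup⁻ (removable P r) (allowed st P (rem r)) _ (length B ≡ᵇ m) t1 t2 , y
  g (inj₂ (r , t1 , B , t2 , y)) = (add r ∷ B) , T-∧-regroup⁻ (addable P r) (allowed st P (add r)) _ (length B ≡ᵇ m) t1 t2 , y
  fg : ∀ z → f (g z) ≡ z
  fg (inj₁ (r , t1 , B , t2 , y)) = cong₂ (λ a b → inj₁ (r , a , B , b , y)) (T-irrelevant _ _) (T-irrelevant _ _)
  fg (inj₂ (r , t1 , B , t2 , y)) = cong₂ (λ a b → inj₂ (r , a , B , b , y)) (T-irrelevant _ _) (T-irrelevant _ _)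
  gf : ∀ z → g (f z) ≡ z
  gf ([] , t , y) = ⊥-elim (T-∧ʳ true t)
  gf ((rem r ∷ B) , t , y) = cong (λ a → (rem r ∷ B) , a , y) (T-irrelevant _ _)
  gf ((add r ∷ B) , t , y) = cong (λ a → (add r ∷ B) , a , y) (T-irrelevant _ _)

Runs-adding-suc : ∀ c Q k Y → Runs (adding c) Q (suc k) Y ↔ RunsByAddition (adding c) Q k Y
Runs-adding-suc c Q k Y = ↔-trans (Runs-suc (adding c) Q k Y) (⊥-⊎-absorb (λ { (r , t , _) → T-∧ʳ (removable Q r) t }))

Runs-removing-suc : ∀ c P m Y → Runs (removing c) P (suc m) Y ↔ (RunsByRemoval (removing c) P m Y ⊎ Runs (adding 0) P (suc m) Y)
Runs-removing-suc c P m Y = ↔-trans (Runs-suc (removing c) P m Y) (↔-refl ⊎-cong ↔-sym (Runs-adding-suc 0 P m Y))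

addStrip? : List ℕ → ℕ → ℕ → List ℕ → Bool
addStrip? Q c k S = isPartition S ∧ (hstrip S Q ∧ (additionsAfter Q S c ∧ ((size S ∸ size Q) ≡ᵇ k)))

AddStrips : List ℕ → ℕ → ℕ → (List ℕ → Set) → Set
AddStrips Q c k Y = Σ (List ℕ) (λ S → T (addStrip? Q c k S) × Y S)

weight : List ℕ → List ℕ → List ℕ → ℕ
weight P S' S = (size P ∸ size S') + (size S ∸ size S')

step? : List ℕ → ℕ → ℕ → List ℕ → List ℕ → Bool
step? P c m S' S = isPartition S' ∧ (isPartition S ∧ (hstrip P S' ∧ (hstrip S S' ∧ (removalsBefore P S' c ∧ (weight P S' S ≡ᵇ m)))))

Steps : List ℕ → ℕ → ℕ → (List ℕ → Set) → Set
Steps P c m Y = Σ (List ℕ × List ℕ) (λ p → T (step? P c m (proj₁ p) (proj₂ p)) × Y (proj₂ p))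

record AddStrip (Q : List ℕ) (c k : ℕ) (S : List ℕ) : Set where
  field
    shape : T (isPartition S)
    interlaced : ∀ j → Interlaced S Q j
    columns : ∀ j → part Q j < part S j → c ≤ part Q j
    size-diff : size S ∸ size Q ≡ k

AddStrip-from : ∀ Q c k S → T (addStrip? Q c k S) → AddStrip Q c k S
AddStrip-from Q c k S t = record
  { shape      = T-∧ˡ (isPartition S) t
  ; interlaced = hstrip⇒Interlaced S Q (T-∧ˡ (hstrip S Q) t₂)
  ; columns    = additionsAfter⇒ Q S c (T-∧ˡ (additionsAfter Q S c) t₃)
  ; size-diff  = T≡ᵇ⇒≡ (T-∧ʳ (additionsAfter Q S c) t₃)
  }
  where
  t₂ = T-∧ʳ (isPartition S) t
  t₃ = T-∧ʳ (hstrip S Q) t₂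

AddStrip-to : ∀ Q c k S → AddStrip Q c k S → T (addStrip? Q c k S)
AddStrip-to Q c k S a =
  T-∧-intro (isPartition S) shape
 (T-∧-intro (hstrip S Q) (Interlaced⇒hstrip S Q interlaced)
 (T-∧-intro (additionsAfter Q S c) (additionsAfter⇐ Q S c columns)
            (≡⇒T≡ᵇ size-diff)))
  where open AddStrip a

record Step (P : List ℕ) (c m : ℕ) (S' S : List ℕ) : Set where
  field
    inner-shape : T (isPartition S')
    shape : T (isPartition S)
    removal-strip : ∀ j → Interlaced P S' j
    addition-strip : ∀ j → Interlaced S S' j
    columns : ∀ j → part S' j < part P j → part P j < c
    weight≡ : weight P S' S ≡ m

Step-from : ∀ P c m S' S → T (step? P c m S' S) → Step P c m S' S
Step-from P c m S' S t = record
  { inner-shape    = T-∧ˡ (isPartition S') t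
  ; shape          = T-∧ˡ (isPartition S) t₂
  ; removal-strip  = hstrip⇒Interlaced P S' (T-∧ˡ (hstrip P S') t₃)
  ; addition-strip = hstrip⇒Interlaced S S' (T-∧ˡ (hstrip S S') t₄)
  ; columns        = removalsBefore⇒ P S' c (T-∧ˡ (removalsBefore P S' c) t₅)
  ; weight≡        = T≡ᵇ⇒≡ (T-∧ʳ (removalsBefore P S' c) t₅)
  }
  where
  t₂ = T-∧ʳ (isPartition S') t
  t₃ = T-∧ʳ (isPartition S) t₂
  t₄ = T-∧ʳ (hstrip P S') t₃
  t₅ = T-∧ʳ (hstrip S S') t₄

Step-to : ∀ P c m S' S → Step P c m S' S → T (step? P c m S' S)
Step-to P c m S' S st =
  T-∧-intro (isPartition S') inner-shape
 (T-∧-intro (isPartition S) shape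
 (T-∧-intro (hstrip P S') (Interlaced⇒hstrip P S' removal-strip)
 (T-∧-intro (hstrip S S') (Interlaced⇒hstrip S S' addition-strip)
 (T-∧-intro (removalsBefore P S' c) (removalsBefore⇐ P S' c columns)
            (≡⇒T≡ᵇ weight≡)))))
  where open Step st

≡-addition-run : ∀ {a : ℕ → Bool} {cc : ℕ → List ℕ → Bool} {Y : List ℕ → Set} {r r' : ℕ} → r' ≡ r →
  (t : T (a r')) (t2 : T (a r)) (S : List ℕ) (u : T (cc r' S)) (u2 : T (cc r S)) (y : Y S) →
  _≡_ {A = Σ ℕ (λ r → T (a r) × Σ (List ℕ) (λ S → T (cc r S) × Y S))} (r' , t , S , u , y) (r , t2 , S , u2 , y)
≡-addition-run refl t t2 S u u2 y = cong₂ (λ t u → (_ , t , S , u , y)) (T-irrelevant t t2) (T-irrelevant u u2)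

≡-removal-step : ∀ {a : ℕ → Bool} {cc : ℕ → List ℕ → List ℕ → Bool} {Y : List ℕ → Set} {r r' : ℕ} → r' ≡ r →
  (t : T (a r')) (t2 : T (a r)) (S' S : List ℕ) (u : T (cc r' S' S)) (u2 : T (cc r S' S)) (y : Y S) →
  _≡_ {A = Σ ℕ (λ r → T (a r) × Σ (List ℕ × List ℕ) (λ p → T (cc r (proj₁ p) (proj₂ p)) × Y (proj₂ p)))}
      (r' , t , (S' , S) , u , y) (r , t2 , (S' , S) , u2 , y)
≡-removal-step refl t t2 S' S u u2 y = cong₂ (λ t u → (_ , t , (S' , S) , u , y)) (T-irrelevant t t2) (T-irrelevant u u2)

subst-refl : ∀ {A : Set} {Y : A → Set} {a : A} (e : a ≡ a) (y : Y a) → subst Y e y ≡ y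
subst-refl refl y = refl

n<ᵇn≡false : ∀ n → (n <ᵇ n) ≡ false
n<ᵇn≡false zero = refl
n<ᵇn≡false (suc n) = n<ᵇn≡false n

∸≡suc∸suc : ∀ a b → b < a → a ∸ b ≡ suc (a ∸ suc b)
∸≡suc∸suc (suc a) zero _ = refl
∸≡suc∸suc (suc a) (suc b) (s≤s h) = ∸≡suc∸suc a b h

Interlaced-refl : ∀ P → T (isPartition P) → ∀ j → Interlaced P P j
Interlaced-refl P t j = ≤-refl , isPartition⇒Decreasing P t j

partition-≡ : ∀ A B → T (isPartition A) → T (isPartition B) → (∀ j → part A j ≤ part B j) → size B ∸ size A ≡ 0 → A ≡ B
partition-≡ A B tA tB h e = part-injective A B (isPartition⇒Positive A tA) (isPartition⇒Positive B tB)
  (size-≡⇒part-≡ A B h (≤-antisym (size-mono A B h) (m∸n≡0⇒m≤n e)))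

AddStrips-zero : ∀ Q c (Y : List ℕ → Set) → T (isPartition Q) → AddStrips Q c 0 Y ↔ Y Q
AddStrips-zero Q c Y tQ = mk↔ₛ′ f g (λ y → subst-refl {Y = Y} _ y) gf
  where
  no-moves : ∀ S → T (addStrip? Q c 0 S) → S ≡ Q
  no-moves S t = sym (partition-≡ Q S tQ shape (λ j → proj₁ (interlaced j)) size-diff)
    where open AddStrip (AddStrip-from Q c 0 S t)
  f : AddStrips Q c 0 Y → Y Q
  f (S , t , y) = subst Y (no-moves S t) y
  g : Y Q → AddStrips Q c 0 Y
  g y = Q , AddStrip-to Q c 0 Q empty , y
    where
    empty : AddStrip Q c 0 Q
    empty = record { shape = tQ ; interlaced = Interlaced-refl Q tQ ; columns = λ j lt → ⊥-elim (<-irrefl refl lt)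
                   ; size-diff = n∸n≡0 (size Q) }
  lem : ∀ S (e : S ≡ Q) (t : T (addStrip? Q c 0 S)) (t' : T (addStrip? Q c 0 Q)) y →
        _≡_ {A = AddStrips Q c 0 Y} (Q , t' , subst Y e y) (S , t , y)
  lem .Q refl t t' y = cong (λ u → Q , u , y) (T-irrelevant _ _)
  gf : ∀ x → g (f x) ≡ x
  gf (S , t , y) = lem S (no-moves S t) t _ y

-- The first box added is the leftmost box of the strip; it lies in the lowest row where S exceeds Q.
module AddStripsByFirstBox (Q : List ℕ) (tQ : T (isPartition Q)) (c k : ℕ) where
  Q-decreasing = isPartition⇒Decreasing Q tQ

  AddStripsAfterFirst : (List ℕ → Set) → Set
  AddStripsAfterFirst Y = Σ ℕ (λ r → T (addable Q r ∧ (c <ᵇ suc (part Q r))) × AddStrips (addBox r Q) (suc (part Q r)) k Y)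

  excess⇒addable : ∀ S → (∀ j → Interlaced S Q j) → ∀ r → part Q r < part S r → T (addable Q r)
  excess⇒addable S interlaced zero _ = tt
  excess⇒addable S interlaced (suc r') lt = <⇒<ᵇ (<-≤-trans lt (proj₂ (interlaced r')))

  module FirstAddition (S : List ℕ) (h : AddStrip Q c (suc k) S) where
    open AddStrip h
    lastExcess-exists : (part Q (lastExcess Q S) < part S (lastExcess Q S)) × (∀ j → lastExcess Q S < j → part S j ≤ part Q j)
    lastExcess-exists with lastExcess-spec Q S
    ... | inj₁ x = x
    ... | inj₂ g' = ⊥-elim (0≢1+n (trans (sym (m≤n⇒m∸n≡0 (size-mono S Q g'))) size-diff))
    r = lastExcess Q S
    lt = proj₁ lastExcess-exists
    no-excess-after = proj₂ lastExcess-exists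
    r-valid : T (addable Q r)
    r-valid = excess⇒addable S interlaced r lt
    r≤length = addable⇒≤length Q r r-valid
    first-allowed : T (addable Q r ∧ (c <ᵇ suc (part Q r)))
    first-allowed = T-∧-intro (addable Q r) r-valid (<⇒<ᵇ (s≤s (columns r lt)))
    interlaced′ : ∀ j → Interlaced S (addBox r Q) j
    interlaced′ j with part-addBox r Q j r≤length
    ... | inj₁ (refl , e) rewrite e = lt , ≤-trans (proj₂ (interlaced r)) (n≤1+n _)
    ... | inj₂ (ne , e) rewrite e = interlaced j
    columns′ : ∀ j → part (addBox r Q) j < part S j → suc (part Q r) ≤ part (addBox r Q) j
    columns′ j lt' with part-addBox r Q j r≤length
    ... | inj₁ (refl , e) = ≤-reflexive (sym e)
    ... | inj₂ (ne , e) rewrite e with <-cmp j r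
    ...   | tri≈ _ b _ = ⊥-elim (ne b)
    ...   | tri> _ _ r<j = ⊥-elim (<⇒≱ lt' (no-excess-after j r<j))
    ...   | tri< j<r _ _ = aux r refl j<r
      where
      aux : ∀ r' → r' ≡ r → j < r' → suc (part Q r) ≤ part Q j
      aux (suc r'') e (s≤s j≤r'') =
        subst (λ z → suc (part Q z) ≤ part Q j) e
          (≤-trans (subst (λ z → part Q z < part S z) (sym e) lt)
                   (≤-trans (proj₂ (interlaced r'')) (Decreasing-mono Q Q-decreasing j≤r'')))
    size-diff′ : size S ∸ size (addBox r Q) ≡ k
    size-diff′ = trans (cong (size S ∸_) (size-addBox r Q r≤length))
                       (trans (sym (pred[m∸n]≡m∸[1+n] (size S) (size Q))) (cong pred size-diff))
    rest : AddStrip (addBox r Q) (suc (part Q r)) k S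
    rest = record { shape = shape ; interlaced = interlaced′ ; columns = columns′ ; size-diff = size-diff′ }

  module WithFirstAddition (r : ℕ) (first-ok : T (addable Q r ∧ (c <ᵇ suc (part Q r))))
                           (S : List ℕ) (h : AddStrip (addBox r Q) (suc (part Q r)) k S) where
    open AddStrip h
    r-valid = T-∧ˡ (addable Q r) first-ok
    c≤part-r : c ≤ part Q r
    c≤part-r = ≤-pred (T<ᵇ⇒< (T-∧ʳ (addable Q r) first-ok))
    r≤length = addable⇒≤length Q r r-valid
    ge : ∀ j → part Q j ≤ part (addBox r Q) j
    ge j with part-addBox r Q j r≤length
    ... | inj₁ (_ , e) = ≤-trans (n≤1+n _) (≤-reflexive (sym e))
    ... | inj₂ (_ , e) = ≤-reflexive (sym e)
    no-excess-after : ∀ j → r < j → part S j ≤ part Q j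
    no-excess-after j r<j = ≮⇒≥ (λ lt → 1+n≰n
      (≤-trans (columns j (subst (_< part S j) (sym e) lt)) (≤-trans (≤-reflexive e) (Decreasing-mono Q Q-decreasing (<⇒≤ r<j)))))
      where
      e : part (addBox r Q) j ≡ part Q j
      e = part-addBox-other r Q j (λ x → <⇒≢ r<j (sym x))
    interlaced-whole : ∀ j → Interlaced S Q j
    interlaced-whole j with j ≟ r
    ... | yes refl = ≤-trans (ge j) (proj₁ (interlaced j)) , ≤-trans (no-excess-after (suc j) ≤-refl) (Q-decreasing j)
    ... | no ne = ≤-trans (ge j) (proj₁ (interlaced j)) , subst (part S (suc j) ≤_) (part-addBox-other r Q j ne) (proj₂ (interlaced j))
    columns-whole : ∀ j → part Q j < part S j → c ≤ part Q j
    columns-whole j lt with j ≟ r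
    ... | yes refl = c≤part-r
    ... | no ne = ≤-trans c≤part-r (≤-trans (n≤1+n _) (≤-trans (columns j (subst (_< part S j) (sym e) lt)) (≤-reflexive e)))
      where
      e = part-addBox-other r Q j ne
    size-grows : suc (size Q) ≤ size S
    size-grows = subst (_≤ size S) (size-addBox r Q r≤length) (size-mono (addBox r Q) S (λ j → proj₁ (interlaced j)))
    size-diff-whole : size S ∸ size Q ≡ suc k
    size-diff-whole = trans (∸≡suc∸suc (size S) (size Q) size-grows)
                            (cong suc (trans (cong (size S ∸_) (sym (size-addBox r Q r≤length))) size-diff))
    whole : AddStrip Q c (suc k) S
    whole = record { shape = shape ; interlaced = interlaced-whole ; columns = columns-whole ; size-diff = size-diff-whole }
    excess-r : part Q r < part S r
    excess-r = <-≤-trans (s≤s ≤-refl) (subst (_≤ part S r) (part-addBox-same r Q r≤length) (proj₁ (interlaced r)))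
    row≡ : lastExcess Q S ≡ r
    row≡ = lastExcess-unique Q S r excess-r no-excess-after

  AddStrips-suc : ∀ Y → AddStrips Q c (suc k) Y ↔ AddStripsAfterFirst Y
  AddStrips-suc Y = mk↔ₛ′ f g fg gf
    where
    f : AddStrips Q c (suc k) Y → AddStripsAfterFirst Y
    f (S , t , y) = r , first-allowed , S , AddStrip-to (addBox r Q) (suc (part Q r)) k S rest , y
      where open FirstAddition S (AddStrip-from Q c (suc k) S t)
    g : AddStripsAfterFirst Y → AddStrips Q c (suc k) Y
    g (r , first-ok , S , t , y) = S , AddStrip-to Q c (suc k) S whole , y
      where open WithFirstAddition r first-ok S (AddStrip-from (addBox r Q) (suc (part Q r)) k S t)
    fg : ∀ z → f (g z) ≡ z
    fg (r , first-ok , S , t , y) = ≡-addition-run {a = λ r → addable Q r ∧ (c <ᵇ suc (part Q r))} {cc = λ r S → addStrip? (addBox r Q) (suc (part Q r)) k S}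
      (WithFirstAddition.row≡ r first-ok S (AddStrip-from (addBox r Q) (suc (part Q r)) k S t)) _ first-ok S _ t y
    gf : ∀ z → g (f z) ≡ z
    gf (S , t , y) = cong (λ u → S , u , y) (T-irrelevant _ _)

AddStrips↔Runs : ∀ Q → T (isPartition Q) → ∀ c k Y → AddStrips Q c k Y ↔ Runs (adding c) Q k Y
AddStrips↔Runs Q tQ c zero Y = ↔-trans (AddStrips-zero Q c Y tQ) (↔-sym (Runs-zero (adding c) Q Y))
AddStrips↔Runs Q tQ c (suc k) Y = ↔-trans (AddStripsByFirstBox.AddStrips-suc Q tQ c k Y)
  (↔-trans (Σ-congʳ (λ r → Σ-congʳ (λ first-ok →
              AddStrips↔Runs (addBox r Q) (isPartition-addBox Q r tQ (T-∧ˡ (addable Q r) first-ok)) (suc (part Q r)) k Y)))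
           (↔-sym (Runs-adding-suc c Q k Y)))

pred< : ∀ n → 1 ≤ n → pred n < n
pred< (suc n) _ = ≤-refl

Steps-zero : ∀ P c (Y : List ℕ → Set) → T (isPartition P) → Steps P c 0 Y ↔ Y P
Steps-zero P c Y tP = mk↔ₛ′ f g (λ y → subst-refl {Y = Y} _ y) gf
  where
  no-moves : ∀ S' S → T (step? P c 0 S' S) → (S' ≡ P) × (S ≡ P)
  no-moves S' S t = S'≡P , trans (sym S'≡S) S'≡P
    where
    open Step (Step-from P c 0 S' S t)
    S'≡P : S' ≡ P
    S'≡P = partition-≡ S' P inner-shape tP (λ j → proj₁ (removal-strip j)) (m+n≡0⇒m≡0 _ weight≡)
    S'≡S : S' ≡ S
    S'≡S = partition-≡ S' S inner-shape shape (λ j → proj₁ (addition-strip j)) (m+n≡0⇒n≡0 (size P ∸ size S') weight≡)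
  f : Steps P c 0 Y → Y P
  f ((S' , S) , t , y) = subst Y (proj₂ (no-moves S' S t)) y
  g : Y P → Steps P c 0 Y
  g y = (P , P) , Step-to P c 0 P P empty , y
    where
    empty : Step P c 0 P P
    empty = record { inner-shape = tP ; shape = tP ; removal-strip = Interlaced-refl P tP ; addition-strip = Interlaced-refl P tP
                   ; columns = λ j lt → ⊥-elim (<-irrefl refl lt) ; weight≡ = cong₂ _+_ (n∸n≡0 (size P)) (n∸n≡0 (size P)) }
  lem : ∀ S' S (e1 : S' ≡ P) (e2 : S ≡ P) (t : T (step? P c 0 S' S)) (t' : T (step? P c 0 P P)) y →
        _≡_ {A = Steps P c 0 Y} ((P , P) , t' , subst Y e2 y) ((S' , S) , t , y)
  lem .P .P refl refl t t' y = cong (λ u → (P , P) , u , y) (T-irrelevant _ _)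
  gf : ∀ x → g (f x) ≡ x
  gf ((S' , S) , t , y) = lem S' S (proj₁ (no-moves S' S t)) (proj₂ (no-moves S' S t)) t _ y

-- The first box removed is the rightmost box of S/S′; it lies in the highest row where S′ is
-- shorter than P.  If S′ = P the step is a pure addition strip.
module StepsByFirstBox (P : List ℕ) (tP : T (isPartition P)) (c m : ℕ) where
  P-decreasing = isPartition⇒Decreasing P tP

  StepsAfterFirstRemoval : (List ℕ → Set) → Set
  StepsAfterFirstRemoval Y = Σ ℕ (λ r → T (removable P r ∧ (part P r <ᵇ c)) × Steps (removeBox r P) (part P r) m Y)
  AddStripsOf : (List ℕ → Set) → Set
  AddStripsOf Y = AddStrips P 0 (suc m) Y

  hasRemoval : List ℕ → Bool
  hasRemoval S' = part S' (firstDeficit P S') <ᵇ part P (firstDeficit P S')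

  size-removeBox-∸ : ∀ r S' → 1 ≤ part P r → size S' ≤ size (removeBox r P) →
                     size P ∸ size S' ≡ suc (size (removeBox r P) ∸ size S')
  size-removeBox-∸ r S' pr le = trans (cong (_∸ size S') (sym (size-removeBox r P pr))) (+-∸-assoc 1 le)

  module FirstRemoval (S' S : List ℕ) (h : Step P c (suc m) S' S) (removal? : hasRemoval S' ≡ true) where
    open Step h
    r = firstDeficit P S'
    lt : part S' r < part P r
    lt = T<ᵇ⇒< (subst T (sym removal?) tt)
    no-deficit-before = firstDeficit-below P S'
    S′-decreasing = isPartition⇒Decreasing S' inner-shape
    part-r-pos : 1 ≤ part P r
    part-r-pos = ≤-trans (s≤s z≤n) lt
    r-valid : T (removable P r)
    r-valid = <⇒<ᵇ (≤-<-trans (proj₂ (removal-strip r)) lt)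
    first-allowed : T (removable P r ∧ (part P r <ᵇ c))
    first-allowed = T-∧-intro (removable P r) r-valid (<⇒<ᵇ (columns r lt))
    removal-strip′ : ∀ j → Interlaced (removeBox r P) S' j
    removal-strip′ j = a , b
      where
      a : part S' j ≤ part (removeBox r P) j
      a with part-removeBox r P j
      ... | inj₁ (refl , e) rewrite e = <⇒≤pred lt
      ... | inj₂ (ne , e) rewrite e = proj₁ (removal-strip j)
      b : part (removeBox r P) (suc j) ≤ part S' j
      b with part-removeBox r P (suc j)
      ... | inj₁ (e1 , e) rewrite e = ≤-trans pred[n]≤n (≤-trans (P-decreasing j) (no-deficit-before j (subst (j <_) e1 ≤-refl)))
      ... | inj₂ (ne , e) rewrite e = proj₂ (removal-strip j)
    columns′ : ∀ j → part S' j < part (removeBox r P) j → part (removeBox r P) j < part P r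
    columns′ j lt' with part-removeBox r P j
    ... | inj₁ (refl , e) rewrite e = pred< _ part-r-pos
    ... | inj₂ (ne , e) rewrite e with <-cmp j r
    ...   | tri< j<r _ _ = ⊥-elim (<⇒≱ lt' (no-deficit-before j j<r))
    ...   | tri≈ _ b _ = ⊥-elim (ne b)
    ...   | tri> _ _ r<j = aux j r<j lt'
      where
      aux : ∀ j → r < j → part S' j < part P j → part P j < part P r
      aux (suc j') (s≤s r≤j') _ = ≤-<-trans (proj₂ (removal-strip j')) (≤-<-trans (Decreasing-mono S' S′-decreasing r≤j') lt)
    weight≡′ : weight (removeBox r P) S' S ≡ m
    weight≡′ = suc-injective (trans (cong (_+ (size S ∸ size S')) (sym (size-removeBox-∸ r S' part-r-pos size-S′≤))) weight≡)
      where
      size-S′≤ : size S' ≤ size (removeBox r P)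
      size-S′≤ = size-mono S' (removeBox r P) (λ j → proj₁ (removal-strip′ j))
    rest : Step (removeBox r P) (part P r) m S' S
    rest = record { inner-shape = inner-shape ; shape = shape ; removal-strip = removal-strip′
                  ; addition-strip = addition-strip ; columns = columns′ ; weight≡ = weight≡′ }

  module NoRemoval (S' S : List ℕ) (h : Step P c (suc m) S' S) (removal? : hasRemoval S' ≡ false) where
    open Step h
    eq : S' ≡ P
    eq with firstDeficit-spec P S'
    ... | inj₁ lt = ⊥-elim (T-false removal? (<⇒<ᵇ lt))
    ... | inj₂ g' = partition-≡ S' P inner-shape tP (λ j → proj₁ (removal-strip j)) (m≤n⇒m∸n≡0 (size-mono P S' g'))
    addition : AddStrip P 0 (suc m) S
    addition = record { shape = shape ; interlaced = λ j → subst (λ X → Interlaced S X j) eq (addition-strip j) ; columns = λ _ _ → z≤n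
                ; size-diff = trans (sym (cong (_+ (size S ∸ size P)) (n∸n≡0 (size P)))) (subst (λ X → weight P X S ≡ suc m) eq weight≡) }

  module WithFirstRemoval (r : ℕ) (first-ok : T (removable P r ∧ (part P r <ᵇ c)))
                          (S' S : List ℕ) (h : Step (removeBox r P) (part P r) m S' S) where
    open Step h
    r-valid : part P (suc r) < part P r
    r-valid = T<ᵇ⇒< (T-∧ˡ (removable P r) first-ok)
    part-r-pos : 1 ≤ part P r
    part-r-pos = ≤-trans (s≤s z≤n) r-valid
    part-r<c : part P r < c
    part-r<c = T<ᵇ⇒< (T-∧ʳ (removable P r) first-ok)
    removeBox-≤ : ∀ j → part (removeBox r P) j ≤ part P j
    removeBox-≤ j with part-removeBox r P j
    ... | inj₁ (_ , e) = ≤-trans (≤-reflexive e) pred[n]≤n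
    ... | inj₂ (_ , e) = ≤-reflexive e
    removal-strip-whole : ∀ j → Interlaced P S' j
    removal-strip-whole j = ≤-trans (proj₁ (removal-strip j)) (removeBox-≤ j) , b
      where
      b : part P (suc j) ≤ part S' j
      b with part-removeBox r P (suc j)
      ... | inj₂ (ne , e) = subst (_≤ part S' j) e (proj₂ (removal-strip j))
      ... | inj₁ (e1 , e) = ≤-trans (P-decreasing j) (≤-trans (≤-reflexive (sym ej)) ge)
        where
        ej : part (removeBox r P) j ≡ part P j
        ej = part-removeBox-other r P j (λ x → <-irrefl (trans x (sym e1)) (n<1+n j))
        ge : part (removeBox r P) j ≤ part S' j
        ge = ≮⇒≥ (λ lt → <-irrefl refl (<-≤-trans (subst (_< part P r) ej (columns j lt)) (subst (λ z → part P z ≤ part P j) e1 (P-decreasing j))))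
    columns-whole : ∀ j → part S' j < part P j → part P j < c
    columns-whole j lt with j ≟ r
    ... | yes refl = part-r<c
    ... | no ne = <-trans (subst (_< part P r) e (columns j (subst (part S' j <_) (sym e) lt))) part-r<c
      where
      e = part-removeBox-other r P j ne
    size-S′≤ : size S' ≤ size (removeBox r P)
    size-S′≤ = size-mono S' (removeBox r P) (λ j → proj₁ (removal-strip j))
    weight≡-whole : weight P S' S ≡ suc m
    weight≡-whole = trans (cong (_+ (size S ∸ size S')) (size-removeBox-∸ r S' part-r-pos size-S′≤)) (cong suc weight≡)
    whole : Step P c (suc m) S' S
    whole = record { inner-shape = inner-shape ; shape = shape ; removal-strip = removal-strip-whole
                   ; addition-strip = addition-strip ; columns = columns-whole ; weight≡ = weight≡-whole }
    deficit-r : part S' r < part P r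
    deficit-r = ≤-<-trans (subst (part S' r ≤_) (part-removeBox-same r P) (proj₁ (removal-strip r))) (pred< _ part-r-pos)
    no-deficit-before : ∀ j → j < r → part P j ≤ part S' j
    no-deficit-before j j<r = subst (_≤ part S' j) e (≮⇒≥ (λ lt → <-irrefl refl
      (<-≤-trans (subst (_< part P r) e (columns j lt)) (Decreasing-mono P P-decreasing (<⇒≤ j<r)))))
      where
      e = part-removeBox-other r P j (<⇒≢ j<r)
    row≡ : firstDeficit P S' ≡ r
    row≡ = firstDeficit-unique P S' r deficit-r no-deficit-before
    hasRemoval≡true : hasRemoval S' ≡ true
    hasRemoval≡true = T⇒≡true (subst (λ z → T (part S' z <ᵇ part P z)) (sym row≡) (<⇒<ᵇ deficit-r))

  module WithoutRemoval (S : List ℕ) (h : AddStrip P 0 (suc m) S) where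
    open AddStrip h
    whole : Step P c (suc m) P S
    whole = record { inner-shape = tP ; shape = shape ; removal-strip = Interlaced-refl P tP ; addition-strip = interlaced ; columns = λ j lt → ⊥-elim (<-irrefl refl lt)
                ; weight≡ = trans (cong (_+ (size S ∸ size P)) (n∸n≡0 (size P))) size-diff }

  Steps-suc : ∀ Y → Steps P c (suc m) Y ↔ (StepsAfterFirstRemoval Y ⊎ AddStripsOf Y)
  Steps-suc Y = mk↔ₛ′ f g f∘g g∘f
    where
    classify : (S' S : List ℕ) → T (step? P c (suc m) S' S) → Y S →
               (b : Bool) → hasRemoval S' ≡ b → StepsAfterFirstRemoval Y ⊎ AddStripsOf Y
    classify S' S t y true  e = inj₁ (r , first-allowed , (S' , S) , Step-to (removeBox r P) (part P r) m S' S rest , y)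
      where open FirstRemoval S' S (Step-from P c (suc m) S' S t) e
    classify S' S t y false e = inj₂ (S , AddStrip-to P 0 (suc m) S addition , y)
      where open NoRemoval S' S (Step-from P c (suc m) S' S t) e
    f : Steps P c (suc m) Y → StepsAfterFirstRemoval Y ⊎ AddStripsOf Y
    f ((S' , S) , t , y) = classify S' S t y (hasRemoval S') refl
    g : StepsAfterFirstRemoval Y ⊎ AddStripsOf Y → Steps P c (suc m) Y
    g (inj₁ (r , first-ok , (S' , S) , t , y)) = (S' , S) , Step-to P c (suc m) S' S whole , y
      where open WithFirstRemoval r first-ok S' S (Step-from (removeBox r P) (part P r) m S' S t)
    g (inj₂ (S , t , y)) = (P , S) , Step-to P c (suc m) P S whole , y
      where open WithoutRemoval S (AddStrip-from P 0 (suc m) S t)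
    step-≡ : ∀ S' S → S' ≡ P → (t : T (step? P c (suc m) S' S)) (t' : T (step? P c (suc m) P S)) (y : Y S) →
             _≡_ {A = Steps P c (suc m) Y} ((P , S) , t' , y) ((S' , S) , t , y)
    step-≡ .P S refl t t' y = cong (λ u → (P , S) , u , y) (T-irrelevant _ _)
    g∘f : ∀ x → g (f x) ≡ x
    g∘f ((S' , S) , t , y) = by-cases (hasRemoval S') refl
      where
      by-cases : ∀ b (e : hasRemoval S' ≡ b) → g (classify S' S t y b e) ≡ ((S' , S) , t , y)
      by-cases true  e = cong (λ u → (S' , S) , u , y) (T-irrelevant _ _)
      by-cases false e = step-≡ S' S (NoRemoval.eq S' S (Step-from P c (suc m) S' S t) e) t _ y
    f∘g : ∀ z → f (g z) ≡ z
    f∘g (inj₁ (r , first-ok , (S' , S) , t , y)) = by-cases (hasRemoval S') refl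
      where
      open WithFirstRemoval r first-ok S' S (Step-from (removeBox r P) (part P r) m S' S t)
      by-cases : ∀ b (e : hasRemoval S' ≡ b) →
                 classify S' S (Step-to P c (suc m) S' S whole) y b e ≡ inj₁ (r , first-ok , (S' , S) , t , y)
      by-cases false e = ⊥-elim (T-false e (T-true hasRemoval≡true))
      by-cases true  e = cong inj₁ (≡-removal-step {a = λ r → removable P r ∧ (part P r <ᵇ c)}
                                                   {cc = λ r S' S → step? (removeBox r P) (part P r) m S' S}
                                                   row≡ _ first-ok S' S _ t y)
    f∘g (inj₂ (S , t , y)) = by-cases (hasRemoval P) refl
      where
      open WithoutRemoval S (AddStrip-from P 0 (suc m) S t)
      by-cases : ∀ b (e : hasRemoval P ≡ b) → classify P S (Step-to P c (suc m) P S whole) y b e ≡ inj₂ (S , t , y)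
      by-cases true  e = ⊥-elim (T-false (n<ᵇn≡false (part P (firstDeficit P P))) (T-true e))
      by-cases false e = cong (λ u → inj₂ (S , u , y)) (T-irrelevant _ _)

Steps↔Runs : ∀ P → T (isPartition P) → ∀ c m Y → Steps P c m Y ↔ Runs (removing c) P m Y
Steps↔Runs P tP c zero Y = ↔-trans (Steps-zero P c Y tP) (↔-sym (Runs-zero (removing c) P Y))
Steps↔Runs P tP c (suc m) Y = ↔-trans (StepsByFirstBox.Steps-suc P tP c m Y)
  (↔-trans (Σ-congʳ (λ r → Σ-congʳ (λ first-ok →
              Steps↔Runs (removeBox r P) (isPartition-removeBox P r tP (T-∧ˡ (removable P r) first-ok)) (part P r) m Y))
            ⊎-cong AddStrips↔Runs P tP 0 (suc m) Y)
           (↔-sym (Runs-removing-suc c P m Y)))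

-- SSOTs as walks

step∞? : List ℕ → ℕ → List ℕ → List ℕ → Bool
step∞? P m S' S = isPartition S' ∧ (isPartition S ∧ (hstrip P S' ∧ (hstrip S S' ∧ (weight P S' S ≡ᵇ m))))

StepsFrom : List ℕ → ℕ → (List ℕ → Set) → Set
StepsFrom P m Y = Σ (List ℕ × List ℕ) (λ p → T (step∞? P m (proj₁ p) (proj₂ p)) × Y (proj₂ p))

StepsFrom↔Runs : ∀ P → T (isPartition P) → ∀ m Y → StepsFrom P m Y ↔ Runs free P m Y
StepsFrom↔Runs P tP m Y = ↔-trans (Σ-congʳ (λ p → ×-congʳ (T-cong (sym (step?≡step∞? (proj₁ p) (proj₂ p))))))
  (↔-trans (Steps↔Runs P tP (suc (part P 0)) m Y)
           (Σ-congʳ (λ B → ×-congʳ (T-cong (cong (_∧ (length B ≡ᵇ m)) (validRun-unbounded B))))))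
  where
  unbounded : ∀ S' → removalsBefore P S' (suc (part P 0)) ≡ true
  unbounded S' = T⇒≡true (removalsBefore⇐ P S' _ (λ j _ → s≤s (Decreasing-mono P (isPartition⇒Decreasing P tP) z≤n)))
  step?≡step∞? : ∀ S' S → step? P (suc (part P 0)) m S' S ≡ step∞? P m S' S
  step?≡step∞? S' S rewrite unbounded S' = refl
  validRun-unbounded : ∀ B → validRun (removing (suc (part P 0))) P B ≡ validRun free P B
  validRun-unbounded [] = refl
  validRun-unbounded (rem r ∷ B)
    rewrite T⇒≡true (<⇒<ᵇ {part P r} {suc (part P 0)} (s≤s (Decreasing-mono P (isPartition⇒Decreasing P tP) z≤n))) = refl
  validRun-unbounded (add r ∷ B) = refl

fitsWalk : Phase → List ℕ → List Move → List ℕ → Bool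
fitsWalk st P [] [] = true
fitsWalk st P (_ ∷ _) [] = false
fitsWalk st P B (zero ∷ e) = fitsWalk free P B e
fitsWalk st P [] (suc m ∷ e) = false
fitsWalk st P (v ∷ B) (suc m ∷ e) = validMove P v ∧ (allowed st P v ∧ fitsWalk (phaseAfter P v) (applyMove v P) B (m ∷ e))

fitsWalk-zero : ∀ st P B e → fitsWalk st P B (zero ∷ e) ≡ fitsWalk free P B e
fitsWalk-zero st P [] e = refl
fitsWalk-zero st P (v ∷ B) e = refl

fitsWalk-++ : ∀ st P B1 B2 e → fitsWalk st P (B1 ++ B2) (length B1 ∷ e) ≡ validRun st P B1 ∧ fitsWalk free (applyMoves P B1) B2 e
fitsWalk-++ st P [] B2 e = fitsWalk-zero st P B2 e
fitsWalk-++ st P (v ∷ B1) B2 e rewrite fitsWalk-++ (phaseAfter P v) (applyMove v P) B1 B2 e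
  | ∧-assoc (validMove P v) (allowed st P v ∧ validRun (phaseAfter P v) (applyMove v P) B1) (fitsWalk free (applyMoves (applyMove v P) B1) B2 e)
  | ∧-assoc (allowed st P v) (validRun (phaseAfter P v) (applyMove v P) B1) (fitsWalk free (applyMoves (applyMove v P) B1) B2 e) = refl

applyMoves-++ : ∀ P B1 B2 → applyMoves P (B1 ++ B2) ≡ applyMoves (applyMoves P B1) B2
applyMoves-++ P [] B2 = refl
applyMoves-++ P (v ∷ B1) B2 = applyMoves-++ (applyMove v P) B1 B2

fitsWalk-length : ∀ st P B e → T (fitsWalk st P B e) → length B ≡ sum e
fitsWalk-length st P [] [] t = refl
fitsWalk-length st P (v ∷ B) (zero ∷ e) t = fitsWalk-length free P (v ∷ B) e t
fitsWalk-length st P [] (zero ∷ e) t = fitsWalk-length free P [] e t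
fitsWalk-length st P (v ∷ B) (suc m ∷ e) t = cong suc (fitsWalk-length (phaseAfter P v) (applyMove v P) B (m ∷ e) (T-∧ʳ (allowed st P v) (T-∧ʳ (validMove P v) t)))

take-length-++ : ∀ {A : Set} (xs ys : List A) → take (length xs) (xs ++ ys) ≡ xs
take-length-++ []       ys = refl
take-length-++ (x ∷ xs) ys = cong (x ∷_) (take-length-++ xs ys)

drop-length-++ : ∀ {A : Set} (xs ys : List A) → drop (length xs) (xs ++ ys) ≡ ys
drop-length-++ []       ys = refl
drop-length-++ (x ∷ xs) ys = drop-length-++ xs ys

length-take-≤ : ∀ {A : Set} m (xs : List A) → m ≤ length xs → length (take m xs) ≡ m
length-take-≤ zero    xs       _         = refl
length-take-≤ (suc m) (x ∷ xs) (s≤s m≤) = cong suc (length-take-≤ m xs m≤)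

∧-T-∧-regroup : ∀ a b c d e f → ((a ∧ (b ∧ (c ∧ (d ∧ e)))) ∧ f) ≡ (a ∧ (b ∧ (c ∧ (d ∧ (e ∧ f)))))
∧-T-∧-regroup true  true  true  true  e f = refl
∧-T-∧-regroup true  true  true  false e f = refl
∧-T-∧-regroup true  true  false d     e f = refl
∧-T-∧-regroup true  false c     d     e f = refl
∧-T-∧-regroup false b     c     d     e f = refl

module _ (la : List ℕ) where

  SSOTsFrom : List ℕ → List ℕ → Set
  SSOTsFrom P e = Σ (List (List ℕ × List ℕ)) (λ d → T (validSSOT P d e la))

  Walks : List ℕ → List ℕ → Set
  Walks P e = Σ (List Move) (λ B → T (fitsWalk free P B e ∧ eqList (applyMoves P B) la))

  SSOTsFrom-∷ : ∀ P m e → SSOTsFrom P (m ∷ e) ↔ StepsFrom P m (λ S → SSOTsFrom S e)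
  SSOTsFrom-∷ P m e = mk↔ₛ′ to from to∘from from∘to
    where
    step-then-rest : ∀ S′ S d → (step∞? P m S′ S ∧ validSSOT S d e la) ≡ validSSOT P ((S′ , S) ∷ d) (m ∷ e) la
    step-then-rest S′ S d = ∧-T-∧-regroup (isPartition S′) (isPartition S) (hstrip P S′) (hstrip S S′) _ _
    to : SSOTsFrom P (m ∷ e) → StepsFrom P m (λ S → SSOTsFrom S e)
    to ([]                 , ())
    to (((S′ , S) ∷ d) , t) =
      let (t₁ , t₂) = Inverse.to (T-∧↔× (step∞? P m S′ S) (validSSOT S d e la))
                                 (subst T (sym (step-then-rest S′ S d)) t)
      in (S′ , S) , t₁ , d , t₂
    from : StepsFrom P m (λ S → SSOTsFrom S e) → SSOTsFrom P (m ∷ e)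
    from ((S′ , S) , t₁ , d , t₂) = ((S′ , S) ∷ d) , subst T (step-then-rest S′ S d) (T-∧-intro (step∞? P m S′ S) t₁ t₂)
    to∘from : ∀ z → to (from z) ≡ z
    to∘from ((S′ , S) , t₁ , d , t₂) = cong₂ (λ a b → (S′ , S) , a , d , b) (T-irrelevant _ _) (T-irrelevant _ _)
    from∘to : ∀ z → from (to z) ≡ z
    from∘to ([]                 , ())
    from∘to (((S′ , S) ∷ d) , t) = cong (((S′ , S) ∷ d) ,_) (T-irrelevant _ _)

  walkCondition-++ : ∀ P B₁ B₂ e →
    (fitsWalk free P (B₁ ++ B₂) (length B₁ ∷ e) ∧ eqList (applyMoves P (B₁ ++ B₂)) la)
      ≡ (validRun free P B₁ ∧ (fitsWalk free (applyMoves P B₁) B₂ e ∧ eqList (applyMoves (applyMoves P B₁) B₂) la))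
  walkCondition-++ P B₁ B₂ e rewrite fitsWalk-++ free P B₁ B₂ e | applyMoves-++ P B₁ B₂ = ∧-assoc (validRun free P B₁) _ _

  Runs-Walks↔Walks : ∀ P m e → Runs free P m (λ S → Walks S e) ↔ Walks P (m ∷ e)
  Runs-Walks↔Walks P m e = mk↔ₛ′ concatenate split concatenate∘split split∘concatenate
    where
    fitsFirst : List Move → ℕ → Bool
    fitsFirst B k = fitsWalk free P B (k ∷ e) ∧ eqList (applyMoves P B) la

    concatenate : Runs free P m (λ S → Walks S e) → Walks P (m ∷ e)
    concatenate (B₁ , t₁ , B₂ , t₂) =
      B₁ ++ B₂ , subst (λ k → T (fitsFirst (B₁ ++ B₂) k)) (T≡ᵇ⇒≡ (T-∧ʳ (validRun free P B₁) t₁))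
                       (subst T (sym (walkCondition-++ P B₁ B₂ e)) (T-∧-intro (validRun free P B₁) (T-∧ˡ (validRun free P B₁) t₁) t₂))

    module Split (B : List Move) (t : T (fitsFirst B m)) where
      first rest′ : List Move
      first = take m B
      rest′ = drop m B
      length-first : length first ≡ m
      length-first = length-take-≤ m B
        (subst (m ≤_) (sym (fitsWalk-length free P B (m ∷ e) (T-∧ˡ (fitsWalk free P B (m ∷ e)) t))) (m≤m+n m (sum e)))
      pieces : T (validRun free P first ∧ (fitsWalk free (applyMoves P first) rest′ e ∧ eqList (applyMoves (applyMoves P first) rest′) la))
      pieces = subst T (walkCondition-++ P first rest′ e)
        (subst (λ X → T (fitsFirst X (length first))) (sym (take++drop≡id m B))
          (subst (λ k → T (fitsFirst B k)) (sym length-first) t))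

    split : Walks P (m ∷ e) → Runs free P m (λ S → Walks S e)
    split (B , t) = first , T-∧-intro (validRun free P first) (T-∧ˡ (validRun free P first) pieces) (≡⇒T≡ᵇ length-first)
                  , rest′ , T-∧ʳ (validRun free P first) pieces
      where open Split B t

    concatenate∘split : ∀ w → concatenate (split w) ≡ w
    concatenate∘split (B , t) = walk-≡ (take++drop≡id m B)
      where
      walk-≡ : ∀ {X} {u : T (fitsFirst X m)} → X ≡ B → _≡_ {A = Walks P (m ∷ e)} (X , u) (B , t)
      walk-≡ refl = cong (B ,_) (T-irrelevant _ _)

    split∘concatenate : ∀ r → split (concatenate r) ≡ r
    split∘concatenate (B₁ , t₁ , B₂ , t₂) =
      run-≡ (subst (λ k → take k (B₁ ++ B₂) ≡ B₁) length≡ (take-length-++ B₁ B₂))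
            (subst (λ k → drop k (B₁ ++ B₂) ≡ B₂) length≡ (drop-length-++ B₁ B₂))
      where
      length≡ : length B₁ ≡ m
      length≡ = T≡ᵇ⇒≡ (T-∧ʳ (validRun free P B₁) t₁)
      run-≡ : ∀ {X₁ X₂ u₁ u₂} → X₁ ≡ B₁ → X₂ ≡ B₂ →
              _≡_ {A = Runs free P m (λ S → Walks S e)} (X₁ , u₁ , X₂ , u₂) (B₁ , t₁ , B₂ , t₂)
      run-≡ refl refl = cong₂ (λ a b → B₁ , a , B₂ , b) (T-irrelevant _ _) (T-irrelevant _ _)

  SSOTsFrom↔Walks : ∀ P → T (isPartition P) → ∀ e → SSOTsFrom P e ↔ Walks P e
  SSOTsFrom↔Walks P _ [] = mk↔ₛ′ to from to∘from from∘to
    where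
    to : SSOTsFrom P [] → Walks P []
    to ([]      , t) = [] , t
    to ((_ ∷ _) , ())
    from : Walks P [] → SSOTsFrom P []
    from ([]      , t) = [] , t
    from ((_ ∷ _) , ())
    to∘from : ∀ w → to (from w) ≡ w
    to∘from ([]      , t) = refl
    to∘from ((_ ∷ _) , ())
    from∘to : ∀ s → from (to s) ≡ s
    from∘to ([]      , t) = refl
    from∘to ((_ ∷ _) , ())
  SSOTsFrom↔Walks P tP (m ∷ e) =
    ↔-trans (SSOTsFrom-∷ P m e)
   (↔-trans (Σ-congʳ (λ { (S′ , S) → Σ-congʳ (λ t →
                SSOTsFrom↔Walks S (T-∧ˡ (isPartition S) (T-∧ʳ (isPartition S′) t)) e) }))
   (↔-trans (StepsFrom↔Runs P tP m (λ S → Walks S e))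
            (Runs-Walks↔Walks P m e)))

validWalk : List ℕ → List Move → Bool
validWalk P [] = true
validWalk P (v ∷ B) = validMove P v ∧ validWalk (applyMove v P) B

candidateMoves : ℕ → List Move
candidateMoves n = concatMap (λ r → rem r ∷ add r ∷ []) (upTo (suc n))

validMoves : List ℕ → List Move
validMoves P = filterᵇ (validMove P) (candidateMoves (length P))

walks : List ℕ → ℕ → List (List Move)
walks P zero = [] ∷ []
walks P (suc k) = concatMap (λ v → map (v ∷_) (walks (applyMove v P) k)) (validMoves P)

ΣList-validMoves : ∀ P (Z : Move → Set) → ΣList (validMoves P) Z ↔ Σ Move (λ v → T (validMove P v) × Z v)
ΣList-validMoves P Z = ↔-trans (ΣList-filterᵇ (validMove P) (candidateMoves (length P)) Z)
  (↔-trans (ΣList-concatMap (λ r → rem r ∷ add r ∷ []) (upTo (suc (length P))) W)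
  (↔-trans (ΣList-applyUpTo (λ x → x) (suc (length P)) _) (mk↔ₛ′ f h fh hf)))
  where
  W : Move → Set
  W v = T (validMove P v) × Z v
  A = Σ ℕ (λ r → T (r <ᵇ suc (length P)) × (W (rem r) ⊎ (W (add r) ⊎ ⊥)))
  f : A → Σ Move W
  f (r , _ , inj₁ w) = rem r , w
  f (r , _ , inj₂ (inj₁ w)) = add r , w
  f (r , _ , inj₂ (inj₂ ()))
  bR : ∀ r → T (removable P r) → T (r <ᵇ suc (length P))
  bR r t = <⇒<ᵇ (≤-trans (part-pos⇒<length P r (≤-trans (s≤s z≤n) (T<ᵇ⇒< t))) (n≤1+n _))
  bA : ∀ r → T (addable P r) → T (r <ᵇ suc (length P))
  bA r t = <⇒<ᵇ (s≤s (addable⇒≤length P r t))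
  h : Σ Move W → A
  h (rem r , w) = r , bR r (proj₁ w) , inj₁ w
  h (add r , w) = r , bA r (proj₁ w) , inj₂ (inj₁ w)
  fh : ∀ z → f (h z) ≡ z
  fh (rem r , w) = refl
  fh (add r , w) = refl
  hf : ∀ z → h (f z) ≡ z
  hf (r , t , inj₁ w) = cong (λ u → r , u , inj₁ w) (T-irrelevant _ _)
  hf (r , t , inj₂ (inj₁ w)) = cong (λ u → r , u , inj₂ (inj₁ w)) (T-irrelevant _ _)
  hf (r , _ , inj₂ (inj₂ ()))

ΣList-walks : ∀ k P (Z : List Move → Set) → ΣList (walks P k) Z ↔ Σ (List Move) (λ B → T (validWalk P B ∧ (length B ≡ᵇ k)) × Z B)
ΣList-walks zero P Z = mk↔ₛ′ f h fh hf
  where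
  f : ΣList (walks P zero) Z → Σ (List Move) (λ B → T (validWalk P B ∧ (length B ≡ᵇ zero)) × Z B)
  f (inj₁ z) = [] , tt , z
  h : Σ (List Move) (λ B → T (validWalk P B ∧ (length B ≡ᵇ zero)) × Z B) → ΣList (walks P zero) Z
  h ([] , _ , z) = inj₁ z
  h ((v ∷ B) , t , z) = ⊥-elim (T-∧ʳ (validWalk P (v ∷ B)) t)
  fh : ∀ x → f (h x) ≡ x
  fh ([] , tt , z) = refl
  fh ((v ∷ B) , t , z) = ⊥-elim (T-∧ʳ (validWalk P (v ∷ B)) t)
  hf : ∀ x → h (f x) ≡ x
  hf (inj₁ z) = refl
ΣList-walks (suc k) P Z = ↔-trans (ΣList-concatMap (λ v → map (v ∷_) (walks (applyMove v P) k)) (validMoves P) Z)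
  (↔-trans (ΣList-cong (validMoves P) (λ v → ↔-trans (ΣList-map (v ∷_) (walks (applyMove v P) k) Z) (ΣList-walks k (applyMove v P) (λ B → Z (v ∷ B)))))
  (↔-trans (ΣList-validMoves P _) (mk↔ₛ′ f h fh hf)))
  where
  A = Σ Move (λ v → T (validMove P v) × Σ (List Move) (λ B → T (validWalk (applyMove v P) B ∧ (length B ≡ᵇ k)) × Z (v ∷ B)))
  C = Σ (List Move) (λ B → T (validWalk P B ∧ (length B ≡ᵇ suc k)) × Z B)
  f : A → C
  f (v , t1 , B , t2 , z) = (v ∷ B) , subst T (sym (∧-assoc (validMove P v) _ _)) (T-∧-intro (validMove P v) t1 t2) , z
  h : C → A
  h ([] , t , z) = ⊥-elim (T-∧ʳ true t)
  h ((v ∷ B) , t , z) = let t' = subst T (∧-assoc (validMove P v) _ _) t in v , T-∧ˡ (validMove P v) t' , B , T-∧ʳ (validMove P v) t' , z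
  fh : ∀ x → f (h x) ≡ x
  fh ([] , t , z) = ⊥-elim (T-∧ʳ true t)
  fh ((v ∷ B) , t , z) = cong (λ u → (v ∷ B) , u , z) (T-irrelevant _ _)
  hf : ∀ x → h (f x) ≡ x
  hf (v , t1 , B , t2 , z) = cong₂ (λ a b → v , a , B , b , z) (T-irrelevant _ _) (T-irrelevant _ _)

phaseMode : Phase → Mode
phaseMode free = start
phaseMode (removing _) = inner
phaseMode (adding _) = inner

descentBits : Phase → List ℕ → List Move → List Bool
descentBits st P [] = []
descentBits st P (v ∷ B) = not (allowed st P v) ∷ descentBits (phaseAfter P v) (applyMove v P) B

fits-start-head : ∀ b b' bs e → fits start (b ∷ bs) e ≡ fits start (b' ∷ bs) e
fits-start-head b b' bs [] = refl
fits-start-head b b' bs (zero ∷ e) = fits-start-head b b' bs e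
fits-start-head b b' bs (suc m ∷ e) = refl

∧-interleave : ∀ a b c d → (a ∧ (b ∧ (c ∧ d))) ≡ ((a ∧ c) ∧ (not (not b) ∧ d))
∧-interleave true true c d = refl
∧-interleave true false true d = refl
∧-interleave true false false d = refl
∧-interleave false b c d = refl

∧-interleave-true : ∀ a c d → (a ∧ (true ∧ (c ∧ d))) ≡ ((a ∧ c) ∧ d)
∧-interleave-true true c d = refl
∧-interleave-true false c d = refl

phaseMode-phaseAfter : ∀ P v → phaseMode (phaseAfter P v) ≡ inner
phaseMode-phaseAfter P (rem r) = refl
phaseMode-phaseAfter P (add r) = refl

fitsWalk≡ : ∀ st P B e → fitsWalk st P B e ≡ (validWalk P B ∧ fits (phaseMode st) (descentBits st P B) e)
fitsWalk≡ st P [] [] = refl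
fitsWalk≡ st P (v ∷ B) [] = sym (∧-zeroʳ _)
fitsWalk≡ st P [] (zero ∷ e) = fitsWalk≡ free P [] e
fitsWalk≡ st P (v ∷ B) (zero ∷ e) = trans (fitsWalk≡ free P (v ∷ B) e) (cong (validWalk P (v ∷ B) ∧_) (fits-start-head _ _ _ e))
fitsWalk≡ st P [] (suc m ∷ e) = refl
fitsWalk≡ free P (v ∷ B) (suc m ∷ e)
  rewrite fitsWalk≡ (phaseAfter P v) (applyMove v P) B (m ∷ e) | phaseMode-phaseAfter P v =
  ∧-interleave-true (validMove P v) _ _
fitsWalk≡ (removing c) P (v ∷ B) (suc m ∷ e)
  rewrite fitsWalk≡ (phaseAfter P v) (applyMove v P) B (m ∷ e) | phaseMode-phaseAfter P v =
  ∧-interleave (validMove P v) (allowed (removing c) P v) _ _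
fitsWalk≡ (adding c) P (v ∷ B) (suc m ∷ e)
  rewrite fitsWalk≡ (phaseAfter P v) (applyMove v P) B (m ∷ e) | phaseMode-phaseAfter P v =
  ∧-interleave (validMove P v) (allowed (adding c) P v) _ _

walksTo : List ℕ → ℕ → List (List Move)
walksTo la n = filterᵇ (λ B → eqList (applyMoves [] B) la) (walks [] n)

descentCompositions : List ℕ → ℕ → List (List ℕ)
descentCompositions la n = map (λ B → descentComposition (descentBits free [] B)) (walksTo la n)

Strong-descentCompositions : ∀ la n → All Strong (descentCompositions la n)
Strong-descentCompositions la n = map⁺ (universal (λ B → Strong-descentComposition (descentBits free [] B)) (walksTo la n))

DescentWalks : List ℕ → ℕ → List ℕ → Set
DescentWalks la n e = Σ (List Move) (λ B → T (validWalk [] B ∧ (length B ≡ᵇ n))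
                                         × T (eqList (applyMoves [] B) la ∧ fits start (descentBits free [] B) e))

Fin-Fcoeffs↔DescentWalks : ∀ la n e → Fin (sum (map (λ a → Fcoeff a e) (descentCompositions la n))) ↔ DescentWalks la n e
Fin-Fcoeffs↔DescentWalks la n e =
  ↔-trans (Fin-sum-map (λ a → Fcoeff a e) (descentCompositions la n))
 (↔-trans (ΣList-map (λ B → descentComposition (descentBits free [] B)) (walksTo la n) (λ a → Fin (Fcoeff a e)))
 (↔-trans (ΣList-cong (walksTo la n) (λ B → ↔-trans (Fin-≡ (Fcoeff-descentComposition (descentBits free [] B) e))
                                                     (Fin-iverson (fits start (descentBits free [] B) e))))
 (↔-trans (ΣList-filterᵇ (λ B → eqList (applyMoves [] B) la) (walks [] n) _)
 (↔-trans (ΣList-walks n [] _)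
          (Σ-congʳ (λ B → Σ-congʳ (λ _ → ↔-sym (T-∧↔× _ _))))))))
  where
  Fin-≡ : ∀ {k l} → k ≡ l → Fin k ↔ Fin l
  Fin-≡ refl = ↔-refl

SSOTwt↔Walks : ∀ la n e →
  SSOTwt la n e ↔ Σ (List Move) (λ B → T (fitsWalk free [] B e ∧ eqList (applyMoves [] B) la) × T (sum e ≡ᵇ n))
SSOTwt↔Walks la n e =
  ↔-trans (Σ-congʳ (λ d → T-∧↔× (validSSOT [] d e la) (sum e ≡ᵇ n)))
 (↔-trans (↔-sym Σ-assoc)
 (↔-trans (×-congʳ (SSOTsFrom↔Walks la [] tt e))
          Σ-assoc))
  where
  Σ-assoc : ∀ {A : Set} {B : A → Set} {C : Set} → (Σ A B × C) ↔ Σ A (λ x → B x × C)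
  Σ-assoc = mk↔ₛ′ (λ { ((x , b) , c) → x , b , c }) (λ { (x , b , c) → (x , b) , c }) (λ _ → refl) (λ _ → refl)

walkConditions↔ : ∀ la n e B →
  (T (fitsWalk free [] B e ∧ eqList (applyMoves [] B) la) × T (sum e ≡ᵇ n))
    ↔ (T (validWalk [] B ∧ (length B ≡ᵇ n)) × T (eqList (applyMoves [] B) la ∧ fits start (descentBits free [] B) e))
walkConditions↔ la n e B =
  ↔-trans (↔-sym (T-∧↔× (fitsWalk free [] B e ∧ ends) (sum e ≡ᵇ n)))
 (↔-trans (T-↔ to from) (T-∧↔× (walk ∧ (length B ≡ᵇ n)) (ends ∧ descents)))
  where
  walk = validWalk [] B
  ends = eqList (applyMoves [] B) la
  descents = fits start (descentBits free [] B) e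
  to : T ((fitsWalk free [] B e ∧ ends) ∧ (sum e ≡ᵇ n)) → T ((walk ∧ (length B ≡ᵇ n)) ∧ (ends ∧ descents))
  to t = T-∧-intro (walk ∧ (length B ≡ᵇ n)) (T-∧-intro walk (T-∧ˡ walk walk∧descents) (≡⇒T≡ᵇ length≡))
                     (T-∧-intro ends (T-∧ʳ (fitsWalk free [] B e) fitting) (T-∧ʳ walk walk∧descents))
    where
    fitting : T (fitsWalk free [] B e ∧ ends)
    fitting = T-∧ˡ (fitsWalk free [] B e ∧ ends) t
    walk∧descents : T (walk ∧ descents)
    walk∧descents = subst T (fitsWalk≡ free [] B e) (T-∧ˡ (fitsWalk free [] B e) fitting)
    length≡ : length B ≡ n
    length≡ = trans (fitsWalk-length free [] B e (T-∧ˡ (fitsWalk free [] B e) fitting)) (T≡ᵇ⇒≡ (T-∧ʳ (fitsWalk free [] B e ∧ ends) t))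
  from : T ((walk ∧ (length B ≡ᵇ n)) ∧ (ends ∧ descents)) → T ((fitsWalk free [] B e ∧ ends) ∧ (sum e ≡ᵇ n))
  from t = T-∧-intro (fitsWalk free [] B e ∧ ends) (T-∧-intro (fitsWalk free [] B e) fitting (T-∧ˡ ends ends∧descents))
                       (≡⇒T≡ᵇ (trans (sym (fitsWalk-length free [] B e fitting)) (T≡ᵇ⇒≡ (T-∧ʳ walk walk∧length))))
    where
    walk∧length : T (walk ∧ (length B ≡ᵇ n))
    walk∧length = T-∧ˡ (walk ∧ (length B ≡ᵇ n)) t
    ends∧descents : T (ends ∧ descents)
    ends∧descents = T-∧ʳ (walk ∧ (length B ≡ᵇ n)) t
    fitting : T (fitsWalk free [] B e)
    fitting = subst T (sym (fitsWalk≡ free [] B e)) (T-∧-intro walk (T-∧ˡ walk walk∧length) (T-∧ʳ ends ends∧descents))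

-- The bijection holds for every la and n.
corollary2p22 : (la : List ℕ) → T (isPartition la) →
                (n : ℕ) → size la ≤ n → n % 2 ≡ size la % 2 →
                Σ (List (List ℕ)) λ L →
                  All Strong L ×
                  ((e : List ℕ) → SSOTwt la n e ↔ Fin (sum (map (λ a → Fcoeff a e) L)))
corollary2p22 la _ n _ _ = descentCompositions la n , Strong-descentCompositions la n , expansion
  where
  expansion : ∀ e → SSOTwt la n e ↔ Fin (sum (map (λ a → Fcoeff a e) (descentCompositions la n)))
  expansion e = begin
    SSOTwt la n e
      ↔⟨ SSOTwt↔Walks la n e ⟩
    Σ (List Move) (λ B → T (fitsWalk free [] B e ∧ eqList (applyMoves [] B) la) × T (sum e ≡ᵇ n))
      ↔⟨ Σ-congʳ (walkConditions↔ la n e) ⟩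
    DescentWalks la n e
      ↔⟨ ↔-sym (Fin-Fcoeffs↔DescentWalks la n e) ⟩
    Fin (sum (map (λ a → Fcoeff a e) (descentCompositions la n)))
      ∎
    where open EquationalReasoning
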